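{- Let $p$ be a prime, $\overline{X} = (X_1, \ldots, X_n)$, and $V$ a finite-dimensional vector space over the field $\mathbb{F}_p(\overline{X})$. Let $M_1, \ldots, M_N \in V$, and let $\varphi_1, \ldots, \varphi_N$ be pairwise commuting $\mathbb{F}_p(\overline{X})$-linear endomorphisms of $V$ such that $\varphi_i(M_j) = \varphi_j(M_i)$ for all $i, j \in \{1, \ldots, N\}$. Then there exist effectively computable $Q \in V$ and $\ell \in \mathbb{N}$ such that \[ \varphi_i^{p^\ell}(Q) = \varphi_i^{p^\ell - 1}(M_i) \quad \text{for all } i = 1, \ldots, N. \]
   Context: $\varphi^m$ denotes the $m$-fold composition; $\mathbb{N}$ contains $0$. -}

module Defs where

open import Data.Nat as ℕ using (ℕ; zero; suc)
open import Data.Integer as ℤ using (ℤ; +_)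
open import Data.Integer.Divisibility using (_∣_)
open import Data.Fin using (Fin) renaming (zero to fzero; suc to fsuc)
open import Data.Vec as Vec using (Vec)
open import Data.Vec.Properties using (≡-dec)
open import Data.List as List using (List; []; _∷_; _++_; concatMap)
open import Data.Product using (_×_; _,_; proj₁; proj₂)
open import Relation.Nullary using (¬_; yes; no)

-- Monomials X₁^{e₁}⋯Xₙ^{eₙ} in n variables, given by exponent vectors.
Mono : ℕ → Set
Mono n = Vec ℕ n

-- Formal integer-coefficient sums of monomials; they represent polynomials
-- in 𝔽ₚ[X₁,…,Xₙ] via the equality _≈P_ below (reduce coefficients mod p).
Poly : ℕ → Set
Poly n = List (ℤ × Mono n)

coeff : ∀ {n} → Poly n → Mono n → ℤ
coeff [] e = + 0
coeff ((c , m) ∷ t) e with ≡-dec ℕ._≟_ m e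
... | yes _ = c ℤ.+ coeff t e
... | no  _ = coeff t e

_≈P[_]_ : ∀ {n} → Poly n → ℕ → Poly n → Set
P ≈P[ p ] Q = ∀ e → + p ∣ (coeff P e ℤ.- coeff Q e)

0P : ∀ {n} → Poly n
0P = []

1P : ∀ {n} → Poly n
1P {n} = (+ 1 , Vec.replicate n 0) ∷ []

_+P_ : ∀ {n} → Poly n → Poly n → Poly n
P +P Q = P ++ Q

_*P_ : ∀ {n} → Poly n → Poly n → Poly n
P *P Q = concatMap (λ t → List.map (λ s → (proj₁ t ℤ.* proj₁ s , Vec.zipWith ℕ._+_ (proj₂ t) (proj₂ s))) Q) P

-- Elements of 𝔽ₚ(X₁,…,Xₙ): fractions num / den.
Frac : ℕ → Set
Frac n = Poly n × Poly n

WF : ∀ {n} → ℕ → Frac n → Set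
WF p x = ¬ (proj₂ x ≈P[ p ] 0P)

_≈F[_]_ : ∀ {n} → Frac n → ℕ → Frac n → Set
(a , b) ≈F[ p ] (c , d) = (a *P d) ≈P[ p ] (c *P b)

0F : ∀ {n} → Frac n
0F = 0P , 1P

_+F_ : ∀ {n} → Frac n → Frac n → Frac n
(a , b) +F (c , d) = ((a *P d) +P (c *P b)) , (b *P d)

_*F_ : ∀ {n} → Frac n → Frac n → Frac n
(a , b) *F (c , d) = (a *P c) , (b *P d)

Vect : ℕ → ℕ → Set
Vect n d = Fin d → Frac n

WFV : ∀ {n d} → ℕ → Vect n d → Set
WFV p v = ∀ k → WF p (v k)

_≈V[_]_ : ∀ {n d} → Vect n d → ℕ → Vect n d → Set
u ≈V[ p ] v = ∀ k → u k ≈F[ p ] v k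

Mat : ℕ → ℕ → Set
Mat n d = Fin d → Fin d → Frac n

WFM : ∀ {n d} → ℕ → Mat n d → Set
WFM p A = ∀ i j → WF p (A i j)

sumF : ∀ {n} d → (Fin d → Frac n) → Frac n
sumF zero f = 0F
sumF (suc d) f = f fzero +F sumF d (λ k → f (fsuc k))

apply : ∀ {n d} → Mat n d → Vect n d → Vect n d
apply {d = d} A v i = sumF d (λ j → A i j *F v j)

iter : ∀ {n d} → Mat n d → ℕ → Vect n d → Vect n d
iter A zero v = v
iter A (suc m) v = apply A (iter A m v)

-- Over the field K = 𝔽ₚ(X₁,…,Xₙ) (fractions of 𝔽ₚ[X], a domain by the leading-monomial
-- argument) every linear map f of K^d satisfies Drazin's condition f^k = f^(k+1) h for k = d²,
-- with h a polynomial in f: the d² + 1 maps f⁰, …, f^(d²) are linearly dependent, and one divides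
-- by the lowest nonvanishing coefficient. Then π = f^k h^k is a projection commuting with everything
-- that commutes with f, with f^m π = f^m for m ≥ k, and β = f^k h^(k+1) satisfies f β = π.
-- For commuting φ₁, …, φ_N the vector Q = π β M₁ + (Q′ - π Q′), with π, β built from φ₁ and Q′
-- obtained by induction for φ₂, …, φ_N, satisfies φᵢ^(m+1) Q = φᵢ^m Mᵢ for all m ≥ d²; this uses
-- φᵢ M₁ = φ₁ Mᵢ. The prime p only enters through 𝔽ₚ[X] being a domain and p^ℓ - 1 ≥ ℓ = d².

{-# OPTIONS --safe #-}
module Submission where

open import Defs
open import Level using (_⊔_; 0ℓ) renaming (suc to lsuc)
open import Algebra.Bundles using (CommutativeRing)
open import Algebra.Structures using (IsCommutativeRing)
import Algebra.Properties.Ring as RingProperties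
import Algebra.Properties.Semiring.Sum as SemiringSum
import Algebra.Solver.Ring.NaturalCoefficients.Default as NaturalCoefficients
open import Data.Nat as ℕ using (ℕ; zero; suc)
import Data.Nat.Properties as ℕP
import Data.Nat.Divisibility as ℕD
open import Data.Nat.Primality using (Prime; euclidsLemma; ¬prime[1]; prime⇒nonTrivial)
import Data.Integer as Int
import Data.Integer.Properties as ℤP
open import Data.Integer.Divisibility.Signed
  using (_∣_; _∣?_; ∣ᵤ⇒∣; ∣⇒∣ᵤ; ∣m∣n⇒∣m+n; ∣m∣n⇒∣m-n; ∣m⇒∣-m; ∣n⇒∣m*n; ∣m⇒∣m*n)
open import Data.Integer.Tactic.RingSolver using (solve-∀)
open import Data.Fin as Fin using (Fin; punchIn) renaming (zero to fzero; suc to fsuc)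
import Data.Fin.Properties as FinP
open import Data.Vec as Vec using (Vec; []; _∷_)
open import Data.Vec.Properties using (≡-dec; zipWith-comm; zipWith-assoc; zipWith-identityˡ)
open import Data.Vec.Functional using (insertAt)
open import Data.Vec.Functional.Properties using (insertAt-lookup; insertAt-punchIn)
open import Data.List as List using (List; []; _∷_; _++_)
import Data.List.Properties as List
open import Data.List.Membership.Propositional using (_∈_; _∉_)
open import Data.List.Relation.Unary.Any using (here; there)
open import Data.Product using (Σ; ∃; _×_; _,_; proj₁; proj₂)
open import Data.Sum as Sum using (_⊎_; inj₁; inj₂)
open import Data.Empty using (⊥-elim)
open import Function using (_∘_; id)
open import Relation.Nullary using (¬_; ¬?; Dec; yes; no)
open import Relation.Nullary.Decidable as Decidable using (decidable-stable)
open import Relation.Binary.Bundles using (Setoid)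
open import Relation.Binary.Definitions using (tri<; tri≈; tri>)
import Relation.Binary.Reasoning.Setoid
import Relation.Binary.PropositionalEquality as ≡

record IsDiscreteDomain {c ℓ} (R : CommutativeRing c ℓ) : Set (c ⊔ ℓ) where
  open CommutativeRing R
  field
    _≈0? : ∀ x → Dec (x ≈ 0#)
    *-≉0 : ∀ {x y} → ¬ x ≈ 0# → ¬ y ≈ 0# → ¬ x * y ≈ 0#
    1≉0 : ¬ 1# ≈ 0#

record DiscreteField c ℓ : Set (lsuc (c ⊔ ℓ)) where
  field
    commutativeRing : CommutativeRing c ℓ
  open CommutativeRing commutativeRing
  field
    _≈0? : ∀ x → Dec (x ≈ 0#)
    inverse : ∀ x → ¬ x ≈ 0# → Carrier
    inverseʳ : ∀ x (x≉0 : ¬ x ≈ 0#) → x * inverse x x≉0 ≈ 1#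
    1≉0 : ¬ 1# ≈ 0#

module FieldOfFractions {c ℓ} (R : CommutativeRing c ℓ) (R-domain : IsDiscreteDomain R) where
  open CommutativeRing R
  open IsDiscreteDomain R-domain

  open RingProperties ring using (-‿distribˡ-*; [y-z]x≈yx-zx; x∙y⁻¹≈ε⇒x≈y; x≈y⇒x∙y⁻¹≈ε)
  open NaturalCoefficients commutativeSemiring using (solve; _:=_; _:+_; _:*_; con)
  open import Relation.Binary.Reasoning.Setoid setoid

  Fraction : Set (c ⊔ ℓ)
  Fraction = Σ (Carrier × Carrier) λ (_ , b) → ¬ b ≈ 0#

  infix 4 _≃_
  record _≃_ (x y : Fraction) : Set ℓ where
    constructor cross
    field cross-≈ : proj₁ (proj₁ x) * proj₂ (proj₁ y) ≈ proj₁ (proj₁ y) * proj₂ (proj₁ x)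

  _⊕_ : Fraction → Fraction → Fraction
  ((a , b) , b≉0) ⊕ ((c , d) , d≉0) = (a * d + c * b , b * d) , *-≉0 b≉0 d≉0

  _⊗_ : Fraction → Fraction → Fraction
  ((a , b) , b≉0) ⊗ ((c , d) , d≉0) = (a * c , b * d) , *-≉0 b≉0 d≉0

  ⊖_ : Fraction → Fraction
  ⊖ ((a , b) , b≉0) = (- a , b) , b≉0

  0ᶠ 1ᶠ : Fraction
  0ᶠ = (0# , 1#) , 1≉0
  1ᶠ = (1# , 1#) , 1≉0

  *-cancelʳ-≉0 : ∀ {x y d} → ¬ d ≈ 0# → x * d ≈ y * d → x ≈ y
  *-cancelʳ-≉0 {x} {y} {d} d≉0 xd≈yd with (x - y) ≈0?
  ... | yes x-y≈0 = x∙y⁻¹≈ε⇒x≈y x y x-y≈0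
  ... | no x-y≉0 = ⊥-elim (*-≉0 x-y≉0 d≉0 (trans ([y-z]x≈yx-zx d x y) (x≈y⇒x∙y⁻¹≈ε xd≈yd)))

  ≃-refl : ∀ {x} → x ≃ x
  ≃-refl = cross refl

  ≃-sym : ∀ {x y} → x ≃ y → y ≃ x
  ≃-sym (cross ad≈cb) = cross (sym ad≈cb)

  ≃-trans : ∀ {x y z} → x ≃ y → y ≃ z → x ≃ z
  ≃-trans {(a , b) , _} {(c , d) , d≉0} {(e , f) , _} (cross ad≈cb) (cross cf≈ed) =
    cross (*-cancelʳ-≉0 d≉0 (begin
      (a * f) * d
        ≈⟨ solve 3 (λ a d f → (a :* f) :* d := (a :* d) :* f) refl a d f ⟩
      (a * d) * f
        ≈⟨ *-congʳ ad≈cb ⟩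
      (c * b) * f
        ≈⟨ solve 3 (λ c b f → (c :* b) :* f := (c :* f) :* b) refl c b f ⟩
      (c * f) * b
        ≈⟨ *-congʳ cf≈ed ⟩
      (e * d) * b
        ≈⟨ solve 3 (λ e d b → (e :* d) :* b := (e :* b) :* d) refl e d b ⟩
      (e * b) * d ∎))

  ⊕-comm : ∀ x y → x ⊕ y ≃ y ⊕ x
  ⊕-comm ((a , b) , _) ((c , d) , _) =
    cross (solve 4 (λ a b c d → (a :* d :+ c :* b) :* (d :* b) := (c :* b :+ a :* d) :* (b :* d)) refl a b c d)

  ⊕-congˡ : ∀ {x x′ y} → x ≃ x′ → x ⊕ y ≃ x′ ⊕ y
  ⊕-congˡ {(a , b) , _} {(a′ , b′) , _} {(c , d) , _} (cross ab′≈a′b) = cross (begin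
    (a * d + c * b) * (b′ * d)
      ≈⟨ solve 5 (λ a b′ c d b → (a :* d :+ c :* b) :* (b′ :* d)
                              := (a :* b′) :* (d :* d) :+ c :* d :* b :* b′) refl a b′ c d b ⟩
    (a * b′) * (d * d) + c * d * b * b′
      ≈⟨ +-congʳ (*-congʳ ab′≈a′b) ⟩
    (a′ * b) * (d * d) + c * d * b * b′
      ≈⟨ solve 5 (λ a′ b c d b′ → (a′ :* b) :* (d :* d) :+ c :* d :* b :* b′
                              := (a′ :* d :+ c :* b′) :* (b :* d)) refl a′ b c d b′ ⟩
    (a′ * d + c * b′) * (b * d) ∎)

  ⊕-cong : ∀ {x x′ y y′} → x ≃ x′ → y ≃ y′ → x ⊕ y ≃ x′ ⊕ y′
  ⊕-cong {x} {x′} {y} {y′} x≃x′ y≃y′ =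
    ≃-trans (⊕-congˡ {y = y} x≃x′)
      (≃-trans (⊕-comm x′ y) (≃-trans (⊕-congˡ {y = x′} y≃y′) (⊕-comm y′ x′)))

  ⊕-assoc : ∀ x y z → (x ⊕ y) ⊕ z ≃ x ⊕ (y ⊕ z)
  ⊕-assoc ((a , b) , _) ((c , d) , _) ((e , f) , _) = cross (solve 6 (λ a b c d e f →
      ((a :* d :+ c :* b) :* f :+ e :* (b :* d)) :* (b :* (d :* f))
    := (a :* (d :* f) :+ (c :* f :+ e :* d) :* b) :* ((b :* d) :* f))
    refl a b c d e f)

  ⊕-identityˡ : ∀ x → 0ᶠ ⊕ x ≃ x
  ⊕-identityˡ ((a , b) , _) =
    cross (solve 2 (λ a b → (con 0 :* b :+ a :* con 1) :* b := a :* (con 1 :* b)) refl a b)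

  ⊖-cong : ∀ {x y} → x ≃ y → ⊖ x ≃ ⊖ y
  ⊖-cong {(a , b) , _} {(c , d) , _} (cross ad≈cb) = cross (begin
    - a * d     ≈⟨ -‿distribˡ-* a d ⟨
    - (a * d)   ≈⟨ -‿cong ad≈cb ⟩
    - (c * b)   ≈⟨ -‿distribˡ-* c b ⟩
    - c * b     ∎)

  ⊖-inverseˡ : ∀ x → (⊖ x) ⊕ x ≃ 0ᶠ
  ⊖-inverseˡ ((a , b) , _) = cross (begin
    (- a * b + a * b) * 1#   ≈⟨ *-identityʳ _ ⟩
    - a * b + a * b          ≈⟨ +-congʳ (-‿distribˡ-* a b) ⟨
    - (a * b) + a * b        ≈⟨ -‿inverseˡ (a * b) ⟩
    0#                       ≈⟨ zeroˡ (b * b) ⟨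
    0# * (b * b)             ∎)

  ⊗-cong : ∀ {x x′ y y′} → x ≃ x′ → y ≃ y′ → x ⊗ y ≃ x′ ⊗ y′
  ⊗-cong {(a , b) , _} {(a′ , b′) , _} {(c , d) , _} {(c′ , d′) , _} (cross ab′≈a′b) (cross cd′≈c′d) =
    cross (begin
      (a * c) * (b′ * d′)
        ≈⟨ solve 4 (λ a c b′ d′ → (a :* c) :* (b′ :* d′) := (a :* b′) :* (c :* d′)) refl a c b′ d′ ⟩
      (a * b′) * (c * d′)
        ≈⟨ *-cong ab′≈a′b cd′≈c′d ⟩
      (a′ * b) * (c′ * d)
        ≈⟨ solve 4 (λ a′ b c′ d → (a′ :* b) :* (c′ :* d) := (a′ :* c′) :* (b :* d)) refl a′ b c′ d ⟩
      (a′ * c′) * (b * d) ∎)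

  ⊗-assoc : ∀ x y z → (x ⊗ y) ⊗ z ≃ x ⊗ (y ⊗ z)
  ⊗-assoc ((a , b) , _) ((c , d) , _) ((e , f) , _) = cross (solve 6 (λ a b c d e f →
    ((a :* c) :* e) :* (b :* (d :* f)) := (a :* (c :* e)) :* ((b :* d) :* f)) refl a b c d e f)

  ⊗-comm : ∀ x y → x ⊗ y ≃ y ⊗ x
  ⊗-comm ((a , b) , _) ((c , d) , _) =
    cross (solve 4 (λ a b c d → (a :* c) :* (d :* b) := (c :* a) :* (b :* d)) refl a b c d)

  ⊗-identityˡ : ∀ x → 1ᶠ ⊗ x ≃ x
  ⊗-identityˡ ((a , b) , _) = cross (solve 2 (λ a b → (con 1 :* a) :* b := a :* (con 1 :* b)) refl a b)

  ⊗-distribˡ-⊕ : ∀ x y z → x ⊗ (y ⊕ z) ≃ (x ⊗ y) ⊕ (x ⊗ z)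
  ⊗-distribˡ-⊕ ((a , b) , _) ((c , d) , _) ((e , f) , _) = cross (solve 6 (λ a b c d e f →
      (a :* (c :* f :+ e :* d)) :* ((b :* d) :* (b :* f))
    := ((a :* c) :* (b :* f) :+ (a :* e) :* (b :* d)) :* (b :* (d :* f)))
    refl a b c d e f)

  fractionRing : CommutativeRing (c ⊔ ℓ) ℓ
  fractionRing = record
    { Carrier = Fraction
    ; _≈_ = _≃_
    ; _+_ = _⊕_
    ; _*_ = _⊗_
    ; -_ = ⊖_
    ; 0# = 0ᶠ
    ; 1# = 1ᶠ
    ; isCommutativeRing = fraction-isCommutativeRing
    }
    where
    fraction-isCommutativeRing : IsCommutativeRing _≃_ _⊕_ _⊗_ ⊖_ 0ᶠ 1ᶠ
    fraction-isCommutativeRing = record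
      { isRing = record
        { +-isAbelianGroup = record
          { isGroup = record
            { isMonoid = record
              { isSemigroup = record
                { isMagma = record
                  { isEquivalence = record { refl = ≃-refl ; sym = ≃-sym ; trans = ≃-trans }
                  ; ∙-cong = ⊕-cong }
                ; assoc = ⊕-assoc }
              ; identity = ⊕-identityˡ , λ x → ≃-trans (⊕-comm x 0ᶠ) (⊕-identityˡ x) }
            ; inverse = ⊖-inverseˡ , λ x → ≃-trans (⊕-comm x (⊖ x)) (⊖-inverseˡ x)
            ; ⁻¹-cong = ⊖-cong }
          ; comm = ⊕-comm }
        ; *-cong = ⊗-cong
        ; *-assoc = ⊗-assoc
        ; *-identity = ⊗-identityˡ , λ x → ≃-trans (⊗-comm x 1ᶠ) (⊗-identityˡ x)
        ; distrib = ⊗-distribˡ-⊕ , λ x y z → ≃-trans (⊗-comm (y ⊕ z) x)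
                                     (≃-trans (⊗-distribˡ-⊕ x y z) (⊕-cong (⊗-comm x y) (⊗-comm x z))) }
      ; *-comm = ⊗-comm }

  ≃0ᶠ⇒numerator≈0 : ∀ {a b b≉0} → ((a , b) , b≉0) ≃ 0ᶠ → a ≈ 0#
  ≃0ᶠ⇒numerator≈0 {a} {b} (cross a1≈0b) = trans (sym (*-identityʳ a)) (trans a1≈0b (zeroˡ b))

  numerator≈0⇒≃0ᶠ : ∀ {a b b≉0} → a ≈ 0# → ((a , b) , b≉0) ≃ 0ᶠ
  numerator≈0⇒≃0ᶠ {a} {b} a≈0 = cross (trans (*-identityʳ a) (trans a≈0 (sym (zeroˡ b))))

  fractionField : DiscreteField (c ⊔ ℓ) ℓ
  fractionField = record
    { commutativeRing = fractionRing
    ; _≈0? = λ ((a , _) , _) → Decidable.map′ numerator≈0⇒≃0ᶠ ≃0ᶠ⇒numerator≈0 (a ≈0?)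
    ; inverse = λ ((a , b) , _) x≉0 → (b , a) , λ a≈0 → x≉0 (numerator≈0⇒≃0ᶠ a≈0)
    ; inverseʳ = λ ((a , b) , _) _ → cross (solve 2 (λ a b → (a :* b) :* con 1 := con 1 :* (b :* a)) refl a b)
    ; 1≉0 = λ 1≃0 → 1≉0 (≃0ᶠ⇒numerator≈0 1≃0)
    }

module MonomialOrder where
  open import Relation.Binary.PropositionalEquality
  open import Data.Vec.Relation.Binary.Lex.Strict as Lex using (Lex-<; this; next)
  open import Data.Vec.Relation.Binary.Pointwise.Inductive using (Pointwise-≡⇒≡; ≡⇒Pointwise-≡)
  open import Relation.Binary.Bundles using (StrictTotalOrder)
  open import Relation.Binary.Definitions using (Trichotomous)

  infixl 6 _⊕_
  _⊕_ : ∀ {k} → Vec ℕ k → Vec ℕ k → Vec ℕ k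
  _⊕_ = Vec.zipWith ℕ._+_

  ⊕-comm : ∀ {k} (a b : Vec ℕ k) → a ⊕ b ≡ b ⊕ a
  ⊕-comm = zipWith-comm ℕP.+-comm

  ⊕-assoc : ∀ {k} (a b c : Vec ℕ k) → (a ⊕ b) ⊕ c ≡ a ⊕ (b ⊕ c)
  ⊕-assoc = zipWith-assoc ℕP.+-assoc

  ⊕-identityˡ : ∀ {k} (a : Vec ℕ k) → Vec.replicate k 0 ⊕ a ≡ a
  ⊕-identityˡ = zipWith-identityˡ ℕP.+-identityˡ

  ⊕-cancelʳ : ∀ {k} (a b c : Vec ℕ k) → a ⊕ c ≡ b ⊕ c → a ≡ b
  ⊕-cancelʳ [] [] [] _ = refl
  ⊕-cancelʳ (x ∷ a) (y ∷ b) (z ∷ c) eq =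
    cong₂ _∷_ (ℕP.+-cancelʳ-≡ z x y (cong Vec.head eq)) (⊕-cancelʳ a b c (cong Vec.tail eq))

  ⊕-cancelˡ : ∀ {k} (a b c : Vec ℕ k) → a ⊕ b ≡ a ⊕ c → b ≡ c
  ⊕-cancelˡ a b c a⊕b≡a⊕c = ⊕-cancelʳ b c a (trans (⊕-comm b a) (trans a⊕b≡a⊕c (⊕-comm a c)))

  infix 4 _<ₗₑₓ_
  _<ₗₑₓ_ : ∀ {k} → Vec ℕ k → Vec ℕ k → Set
  _<ₗₑₓ_ = Lex-< _≡_ ℕ._<_

  private
    module Lexicographic k = StrictTotalOrder (Lex.<-strictTotalOrder ℕP.<-strictTotalOrder k)

  <ₗₑₓ-irrefl : ∀ {k} (a : Vec ℕ k) → ¬ a <ₗₑₓ a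
  <ₗₑₓ-irrefl {k} a = Lexicographic.irrefl k (≡⇒Pointwise-≡ refl)

  <ₗₑₓ-trans : ∀ {k} {a b c : Vec ℕ k} → a <ₗₑₓ b → b <ₗₑₓ c → a <ₗₑₓ c
  <ₗₑₓ-trans {k} = Lexicographic.trans k

  <ₗₑₓ-cmp : ∀ {k} → Trichotomous _≡_ (_<ₗₑₓ_ {k})
  <ₗₑₓ-cmp {k} a b with Lexicographic.compare k a b
  ... | tri< a<b a≢b a≯b = tri< a<b (a≢b ∘ ≡⇒Pointwise-≡) a≯b
  ... | tri≈ a≮b a≡b a≯b = tri≈ a≮b (Pointwise-≡⇒≡ a≡b) a≯b
  ... | tri> a≮b a≢b a>b = tri> a≮b (a≢b ∘ ≡⇒Pointwise-≡) a>b

  ⊕-monoˡ-<ₗₑₓ : ∀ {k} {a b : Vec ℕ k} c → a <ₗₑₓ b → a ⊕ c <ₗₑₓ b ⊕ c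
  ⊕-monoˡ-<ₗₑₓ (z ∷ c) (this x<y refl) = this (ℕP.+-monoˡ-< z x<y) refl
  ⊕-monoˡ-<ₗₑₓ (z ∷ c) (next refl a<b) = next refl (⊕-monoˡ-<ₗₑₓ c a<b)

  ⊕-monoʳ-<ₗₑₓ : ∀ {k} {a b : Vec ℕ k} c → a <ₗₑₓ b → c ⊕ a <ₗₑₓ c ⊕ b
  ⊕-monoʳ-<ₗₑₓ {a = a} {b} c a<b = subst₂ _<ₗₑₓ_ (⊕-comm a c) (⊕-comm b c) (⊕-monoˡ-<ₗₑₓ c a<b)

  <ₗₑₓ-⊕-exchange : ∀ {k} {a b c d : Vec ℕ k} → a <ₗₑₓ c → a ⊕ b ≡ c ⊕ d → d <ₗₑₓ b
  <ₗₑₓ-⊕-exchange {a = a} {b} {c} {d} a<c a⊕b≡c⊕d with <ₗₑₓ-cmp b d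
  ... | tri< b<d _ _ = ⊥-elim (<ₗₑₓ-irrefl (a ⊕ b) (subst (a ⊕ b <ₗₑₓ_) (sym a⊕b≡c⊕d)
                                 (<ₗₑₓ-trans (⊕-monoˡ-<ₗₑₓ b a<c) (⊕-monoʳ-<ₗₑₓ c b<d))))
  ... | tri≈ _ refl _ = ⊥-elim (<ₗₑₓ-irrefl c (subst (_<ₗₑₓ c) (⊕-cancelʳ a c b a⊕b≡c⊕d) a<c))
  ... | tri> _ _ d<b = d<b

module PolynomialsModP (p n : ℕ) where
  open import Relation.Binary.PropositionalEquality
  open Int using (ℤ; +_; _+_; _*_; -_; _-_)
  open MonomialOrder
  open import Data.List.Membership.DecPropositional (≡-dec {n = n} ℕ._≟_) using (_∈?_)

  infix 4 _≡ₚ_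
  record _≡ₚ_ (x y : ℤ) : Set where
    constructor divides-difference
    field multiple : + p ∣ (x - y)
  open _≡ₚ_

  p∣0 : + p ∣ + 0
  p∣0 = ∣ᵤ⇒∣ (p ℕD.∣0)

  ≡⇒≡ₚ : ∀ {x y} → x ≡ y → x ≡ₚ y
  ≡⇒≡ₚ {x} refl = divides-difference (subst (+ p ∣_) (sym (ℤP.+-inverseʳ x)) p∣0)

  ≡ₚ-sym : ∀ {x y} → x ≡ₚ y → y ≡ₚ x
  ≡ₚ-sym {x} {y} (divides-difference d) = divides-difference (subst (+ p ∣_) (eq x y) (∣m⇒∣-m d))
    where eq : ∀ x y → - (x - y) ≡ y - x
          eq = solve-∀

  ≡ₚ-trans : ∀ {x y z} → x ≡ₚ y → y ≡ₚ z → x ≡ₚ z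
  ≡ₚ-trans {x} {y} {z} (divides-difference d) (divides-difference e) =
    divides-difference (subst (+ p ∣_) (eq x y z) (∣m∣n⇒∣m+n d e))
    where eq : ∀ x y z → (x - y) + (y - z) ≡ x - z
          eq = solve-∀

  ≡ₚ-+ : ∀ {x x′ y y′} → x ≡ₚ x′ → y ≡ₚ y′ → x + y ≡ₚ x′ + y′
  ≡ₚ-+ {x} {x′} {y} {y′} (divides-difference d) (divides-difference e) =
    divides-difference (subst (+ p ∣_) (eq x x′ y y′) (∣m∣n⇒∣m+n d e))
    where eq : ∀ x x′ y y′ → (x - x′) + (y - y′) ≡ (x + y) - (x′ + y′)
          eq = solve-∀

  ≡ₚ-neg : ∀ {x y} → x ≡ₚ y → - x ≡ₚ - y
  ≡ₚ-neg {x} {y} (divides-difference d) = divides-difference (subst (+ p ∣_) (eq x y) (∣m⇒∣-m d))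
    where eq : ∀ x y → - (x - y) ≡ - x - - y
          eq = solve-∀

  ≡ₚ-*ˡ : ∀ c {x y} → x ≡ₚ y → c * x ≡ₚ c * y
  ≡ₚ-*ˡ c {x} {y} (divides-difference d) = divides-difference (subst (+ p ∣_) (eq c x y) (∣n⇒∣m*n c d))
    where eq : ∀ c x y → c * (x - y) ≡ c * x - c * y
          eq = solve-∀

  ≡ₚ0⇒∣ : ∀ {x} → x ≡ₚ + 0 → + p ∣ x
  ≡ₚ0⇒∣ {x} (divides-difference d) = subst (+ p ∣_) (ℤP.+-identityʳ x) d

  ∣⇒≡ₚ0 : ∀ {x} → + p ∣ x → x ≡ₚ + 0
  ∣⇒≡ₚ0 {x} d = divides-difference (subst (+ p ∣_) (sym (ℤP.+-identityʳ x)) d)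

  ⟪_,_⟫ : Poly n → (Mono n → ℤ) → ℤ
  ⟪ [] , f ⟫ = + 0
  ⟪ (c , m) ∷ P , f ⟫ = c * f m + ⟪ P , f ⟫

  indicator : Mono n → Mono n → ℤ
  indicator e a with ≡-dec ℕ._≟_ a e
  ... | yes _ = + 1
  ... | no _ = + 0

  coeff≡⟪indicator⟫ : ∀ P e → coeff P e ≡ ⟪ P , indicator e ⟫
  coeff≡⟪indicator⟫ [] e = refl
  coeff≡⟪indicator⟫ ((c , m) ∷ P) e with ≡-dec ℕ._≟_ m e
  ... | yes _ = cong₂ _+_ (sym (ℤP.*-identityʳ c)) (coeff≡⟪indicator⟫ P e)
  ... | no _ = trans (coeff≡⟪indicator⟫ P e)
                     (sym (trans (cong (_+ ⟪ P , indicator e ⟫) (ℤP.*-zeroʳ c)) (ℤP.+-identityˡ _)))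

  ⟪⟫-cong : ∀ P {f g} → (∀ a → f a ≡ g a) → ⟪ P , f ⟫ ≡ ⟪ P , g ⟫
  ⟪⟫-cong [] f≗g = refl
  ⟪⟫-cong ((c , m) ∷ P) f≗g = cong₂ (λ u v → c * u + v) (f≗g m) (⟪⟫-cong P f≗g)

  ⟪⟫-zeroʳ : ∀ P → ⟪ P , (λ _ → + 0) ⟫ ≡ + 0
  ⟪⟫-zeroʳ [] = refl
  ⟪⟫-zeroʳ ((c , m) ∷ P) rewrite ⟪⟫-zeroʳ P | ℤP.*-zeroʳ c = refl

  ⟪⟫-distrib-+ : ∀ P f g → ⟪ P , (λ a → f a + g a) ⟫ ≡ ⟪ P , f ⟫ + ⟪ P , g ⟫
  ⟪⟫-distrib-+ [] f g = refl
  ⟪⟫-distrib-+ ((c , m) ∷ P) f g rewrite ⟪⟫-distrib-+ P f g = eq c (f m) (g m) ⟪ P , f ⟫ ⟪ P , g ⟫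
    where eq : ∀ c x y u v → c * (x + y) + (u + v) ≡ (c * x + u) + (c * y + v)
          eq = solve-∀

  ⟪⟫-*ˡ : ∀ P c f → ⟪ P , (λ a → c * f a) ⟫ ≡ c * ⟪ P , f ⟫
  ⟪⟫-*ˡ [] c f = sym (ℤP.*-zeroʳ c)
  ⟪⟫-*ˡ ((d , m) ∷ P) c f rewrite ⟪⟫-*ˡ P c f = eq c d (f m) ⟪ P , f ⟫
    where eq : ∀ c d x u → d * (c * x) + c * u ≡ c * (d * x + u)
          eq = solve-∀

  ⟪⟫-comm : ∀ P Q (F : Mono n → Mono n → ℤ) →
            ⟪ P , (λ a → ⟪ Q , F a ⟫) ⟫ ≡ ⟪ Q , (λ b → ⟪ P , (λ a → F a b) ⟫) ⟫
  ⟪⟫-comm [] Q F = sym (⟪⟫-zeroʳ Q)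
  ⟪⟫-comm ((c , m) ∷ P) Q F = begin
    c * ⟪ Q , F m ⟫ + ⟪ P , (λ a → ⟪ Q , F a ⟫) ⟫
      ≡⟨ cong₂ _+_ (sym (⟪⟫-*ˡ Q c (F m))) (⟪⟫-comm P Q F) ⟩
    ⟪ Q , (λ b → c * F m b) ⟫ + ⟪ Q , (λ b → ⟪ P , (λ a → F a b) ⟫) ⟫
      ≡⟨ sym (⟪⟫-distrib-+ Q _ _) ⟩
    ⟪ Q , (λ b → c * F m b + ⟪ P , (λ a → F a b) ⟫) ⟫ ∎
    where open ≡-Reasoning

  ⟪⟫-++ : ∀ P Q f → ⟪ P ++ Q , f ⟫ ≡ ⟪ P , f ⟫ + ⟪ Q , f ⟫
  ⟪⟫-++ [] Q f = sym (ℤP.+-identityˡ _)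
  ⟪⟫-++ ((c , m) ∷ P) Q f rewrite ⟪⟫-++ P Q f = sym (ℤP.+-assoc (c * f m) ⟪ P , f ⟫ ⟪ Q , f ⟫)

  negP : Poly n → Poly n
  negP = List.map (λ (c , m) → (- c , m))

  ⟪negP⟫ : ∀ P f → ⟪ negP P , f ⟫ ≡ - ⟪ P , f ⟫
  ⟪negP⟫ [] f = refl
  ⟪negP⟫ ((c , m) ∷ P) f rewrite ⟪negP⟫ P f = eq c (f m) ⟪ P , f ⟫
    where eq : ∀ c x u → - c * x + - u ≡ - (c * x + u)
          eq = solve-∀

  ⟪*P⟫ : ∀ P Q f → ⟪ P *P Q , f ⟫ ≡ ⟪ P , (λ a → ⟪ Q , (λ b → f (a ⊕ b)) ⟫) ⟫
  ⟪*P⟫ [] Q f = refl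
  ⟪*P⟫ ((c , m) ∷ P) Q f = begin
    ⟪ scaled Q ++ P *P Q , f ⟫                ≡⟨ ⟪⟫-++ (scaled Q) (P *P Q) f ⟩
    ⟪ scaled Q , f ⟫ + ⟪ P *P Q , f ⟫         ≡⟨ cong₂ _+_ (⟪scaled⟫ Q) (⟪*P⟫ P Q f) ⟩
    c * ⟪ Q , (λ b → f (m ⊕ b)) ⟫ + _         ∎
    where
    open ≡-Reasoning
    scaled : Poly n → Poly n
    scaled = List.map (λ (d , b) → (c * d , m ⊕ b))
    ⟪scaled⟫ : ∀ Q → ⟪ scaled Q , f ⟫ ≡ c * ⟪ Q , (λ b → f (m ⊕ b)) ⟫
    ⟪scaled⟫ [] = sym (ℤP.*-zeroʳ c)
    ⟪scaled⟫ ((d , b) ∷ Q) rewrite ⟪scaled⟫ Q = eq c d (f (m ⊕ b)) ⟪ Q , (λ b → f (m ⊕ b)) ⟫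
      where eq : ∀ c d x u → (c * d) * x + c * u ≡ c * (d * x + u)
            eq = solve-∀

  coeff-++ : ∀ P Q e → coeff (P ++ Q) e ≡ coeff P e + coeff Q e
  coeff-++ P Q e
    rewrite coeff≡⟪indicator⟫ (P ++ Q) e | coeff≡⟪indicator⟫ P e | coeff≡⟪indicator⟫ Q e = ⟪⟫-++ P Q _

  coeff-negP : ∀ P e → coeff (negP P) e ≡ - coeff P e
  coeff-negP P e rewrite coeff≡⟪indicator⟫ (negP P) e | coeff≡⟪indicator⟫ P e = ⟪negP⟫ P _

  coeff-*P : ∀ P Q e → coeff (P *P Q) e ≡ ⟪ P , (λ a → ⟪ Q , (λ b → indicator e (a ⊕ b)) ⟫) ⟫
  coeff-*P P Q e rewrite coeff≡⟪indicator⟫ (P *P Q) e = ⟪*P⟫ P Q _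

  ⟪⟫-cong-≡ₚ : ∀ P {f g} → (∀ a → f a ≡ₚ g a) → ⟪ P , f ⟫ ≡ₚ ⟪ P , g ⟫
  ⟪⟫-cong-≡ₚ [] f≡g = ≡⇒≡ₚ refl
  ⟪⟫-cong-≡ₚ ((c , m) ∷ P) f≡g = ≡ₚ-+ (≡ₚ-*ˡ c (f≡g m)) (⟪⟫-cong-≡ₚ P f≡g)

  delete : Mono n → Poly n → Poly n
  delete a [] = []
  delete a ((c , m) ∷ P) with ≡-dec ℕ._≟_ m a
  ... | yes _ = delete a P
  ... | no _ = (c , m) ∷ delete a P

  ⟪⟫-delete : ∀ a P f → ⟪ P , f ⟫ ≡ coeff P a * f a + ⟪ delete a P , f ⟫
  ⟪⟫-delete a [] f = sym (trans (ℤP.+-identityʳ _) (ℤP.*-zeroˡ (f a)))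
  ⟪⟫-delete a ((c , m) ∷ P) f with ≡-dec ℕ._≟_ m a
  ... | yes refl rewrite ⟪⟫-delete m P f = eq c (coeff P m) (f m) ⟪ delete m P , f ⟫
    where eq : ∀ c d x u → c * x + (d * x + u) ≡ (c + d) * x + u
          eq = solve-∀
  ... | no _ rewrite ⟪⟫-delete a P f = eq c (coeff P a) (f m) (f a) ⟪ delete a P , f ⟫
    where eq : ∀ c d x y u → c * x + (d * y + u) ≡ d * y + (c * x + u)
          eq = solve-∀

  coeff-delete-≡ : ∀ a P → coeff (delete a P) a ≡ + 0
  coeff-delete-≡ a [] = refl
  coeff-delete-≡ a ((c , m) ∷ P) with ≡-dec ℕ._≟_ m a
  ... | yes _ = coeff-delete-≡ a P
  ... | no m≢a with ≡-dec ℕ._≟_ m a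
  ...   | yes m≡a = ⊥-elim (m≢a m≡a)
  ...   | no _ = coeff-delete-≡ a P

  coeff-delete-≢ : ∀ a b P → a ≢ b → coeff (delete a P) b ≡ coeff P b
  coeff-delete-≢ a b [] a≢b = refl
  coeff-delete-≢ a b ((c , m) ∷ P) a≢b with ≡-dec ℕ._≟_ m a
  coeff-delete-≢ a b ((c , m) ∷ P) a≢b | yes refl with ≡-dec ℕ._≟_ m b
  ... | yes refl = ⊥-elim (a≢b refl)
  ... | no _ = coeff-delete-≢ a b P a≢b
  coeff-delete-≢ a b ((c , m) ∷ P) a≢b | no _ with ≡-dec ℕ._≟_ m b
  ... | yes _ = cong (λ x → c + x) (coeff-delete-≢ a b P a≢b)
  ... | no _ = coeff-delete-≢ a b P a≢b

  length-delete : ∀ a P → List.length (delete a P) ℕ.≤ List.length P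
  length-delete a [] = ℕ.z≤n
  length-delete a ((c , m) ∷ P) with ≡-dec ℕ._≟_ m a
  ... | yes _ = ℕP.m≤n⇒m≤1+n (length-delete a P)
  ... | no _ = ℕ.s≤s (length-delete a P)

  length-delete-head : ∀ c m P → List.length (delete m ((c , m) ∷ P)) ℕ.≤ List.length P
  length-delete-head c m P with ≡-dec ℕ._≟_ m m
  ... | yes _ = length-delete m P
  ... | no m≢m = ⊥-elim (m≢m refl)

  p∣coeff-delete : ∀ m P (f : Mono n → ℤ) → (∀ a → a ≢ m → + p ∣ coeff P a * f a) →
                   ∀ a → + p ∣ coeff (delete m P) a * f a
  p∣coeff-delete m P f p∣others a with ≡-dec ℕ._≟_ m a
  ... | yes refl rewrite coeff-delete-≡ m P | ℤP.*-zeroˡ (f m) = p∣0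
  ... | no m≢a rewrite coeff-delete-≢ m a P m≢a = p∣others a (m≢a ∘ sym)

  -- A monomial may occur in several terms of P, so P is shrunk by deleting
  -- whole monomials rather than single terms.
  ⟪⟫-vanishing : ∀ P f → (∀ a → + p ∣ coeff P a * f a) → + p ∣ ⟪ P , f ⟫
  ⟪⟫-vanishing P f = go (List.length P) P ℕP.≤-refl
    where
    go : ∀ k P → List.length P ℕ.≤ k → (∀ a → + p ∣ coeff P a * f a) → + p ∣ ⟪ P , f ⟫
    go k [] _ _ = p∣0
    go (suc k) P@((c , m) ∷ P′) (ℕ.s≤s |P′|≤k) p∣cf =
      subst (+ p ∣_) (sym (⟪⟫-delete m P f))
        (∣m∣n⇒∣m+n (p∣cf m) (go k (delete m P) (ℕP.≤-trans (length-delete-head c m P′) |P′|≤k)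
                                               (p∣coeff-delete m P f (λ a _ → p∣cf a))))

  ⟪⟫-single : ∀ P (f : Mono n → ℤ) m → (∀ a → a ≢ m → + p ∣ coeff P a * f a) →
              ⟪ P , f ⟫ ≡ₚ coeff P m * f m
  ⟪⟫-single P f m p∣others = divides-difference (subst (+ p ∣_) ⟪P⟫-cm
    (⟪⟫-vanishing (delete m P) f (p∣coeff-delete m P f p∣others)))
    where
    cancel : ∀ x y → y ≡ (x + y) - x
    cancel = solve-∀
    ⟪P⟫-cm : ⟪ delete m P , f ⟫ ≡ ⟪ P , f ⟫ - coeff P m * f m
    ⟪P⟫-cm = trans (cancel (coeff P m * f m) _) (cong (_- coeff P m * f m) (sym (⟪⟫-delete m P f)))

  infix 4 _≈_
  record _≈_ (P Q : Poly n) : Set where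
    constructor coeffwise
    field coeff-≡ₚ : ∀ e → coeff P e ≡ₚ coeff Q e
  open _≈_

  ≈P⇒≈ : ∀ {P Q} → P ≈P[ p ] Q → P ≈ Q
  ≈P⇒≈ P≈Q = coeffwise (λ e → divides-difference (∣ᵤ⇒∣ (P≈Q e)))

  ≈⇒≈P : ∀ {P Q} → P ≈ Q → P ≈P[ p ] Q
  ≈⇒≈P (coeffwise P≡Q) e = ∣⇒∣ᵤ (multiple (P≡Q e))

  coeff-≡⇒≈ : ∀ {P Q} → (∀ e → coeff P e ≡ coeff Q e) → P ≈ Q
  coeff-≡⇒≈ eq = coeffwise (λ e → ≡⇒≡ₚ (eq e))

  ⟪⟫-resp-≈ : ∀ {P Q} → P ≈ Q → ∀ f → ⟪ P , f ⟫ ≡ₚ ⟪ Q , f ⟫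
  ⟪⟫-resp-≈ {P} {Q} (coeffwise P≡Q) f =
    divides-difference (subst (+ p ∣_) ⟪P-Q⟫ (⟪⟫-vanishing (P ++ negP Q) f p∣coeff))
    where
    coeff-P-Q : ∀ a → coeff (P ++ negP Q) a ≡ coeff P a - coeff Q a
    coeff-P-Q a = trans (coeff-++ P (negP Q) a) (cong (λ x → coeff P a + x) (coeff-negP Q a))
    p∣coeff : ∀ a → + p ∣ coeff (P ++ negP Q) a * f a
    p∣coeff a = ∣m⇒∣m*n (f a) (subst (+ p ∣_) (sym (coeff-P-Q a)) (multiple (P≡Q a)))
    ⟪P-Q⟫ : ⟪ P ++ negP Q , f ⟫ ≡ ⟪ P , f ⟫ - ⟪ Q , f ⟫
    ⟪P-Q⟫ = trans (⟪⟫-++ P (negP Q) f) (cong (λ x → ⟪ P , f ⟫ + x) (⟪negP⟫ Q f))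

  ≈-refl : ∀ {P} → P ≈ P
  ≈-refl = coeff-≡⇒≈ (λ _ → refl)

  ≈-sym : ∀ {P Q} → P ≈ Q → Q ≈ P
  ≈-sym (coeffwise P≡Q) = coeffwise (λ e → ≡ₚ-sym (P≡Q e))

  ≈-trans : ∀ {P Q R} → P ≈ Q → Q ≈ R → P ≈ R
  ≈-trans (coeffwise P≡Q) (coeffwise Q≡R) = coeffwise (λ e → ≡ₚ-trans (P≡Q e) (Q≡R e))

  +P-cong : ∀ {P P′ Q Q′} → P ≈ P′ → Q ≈ Q′ → P +P Q ≈ P′ +P Q′
  +P-cong {P} {P′} {Q} {Q′} (coeffwise P≡P′) (coeffwise Q≡Q′) = coeffwise λ e →
    subst₂ _≡ₚ_ (sym (coeff-++ P Q e)) (sym (coeff-++ P′ Q′ e)) (≡ₚ-+ (P≡P′ e) (Q≡Q′ e))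

  negP-cong : ∀ {P Q} → P ≈ Q → negP P ≈ negP Q
  negP-cong {P} {Q} (coeffwise P≡Q) = coeffwise λ e →
    subst₂ _≡ₚ_ (sym (coeff-negP P e)) (sym (coeff-negP Q e)) (≡ₚ-neg (P≡Q e))

  *P-cong : ∀ {P P′ Q Q′} → P ≈ P′ → Q ≈ Q′ → P *P Q ≈ P′ *P Q′
  *P-cong {P} {P′} {Q} {Q′} P≈P′ Q≈Q′ = coeffwise λ e →
    subst₂ _≡ₚ_ (sym (coeff-*P P Q e)) (sym (coeff-*P P′ Q′ e))
      (≡ₚ-trans (⟪⟫-resp-≈ P≈P′ _) (⟪⟫-cong-≡ₚ P′ (λ a → ⟪⟫-resp-≈ Q≈Q′ _)))

  +P-comm : ∀ P Q → P +P Q ≈ Q +P P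
  +P-comm P Q = coeff-≡⇒≈ λ e →
    trans (coeff-++ P Q e) (trans (ℤP.+-comm (coeff P e) (coeff Q e)) (sym (coeff-++ Q P e)))

  negP-inverseˡ : ∀ P → negP P +P P ≈ 0P
  negP-inverseˡ P = coeff-≡⇒≈ λ e →
    trans (coeff-++ (negP P) P e) (trans (cong (_+ coeff P e) (coeff-negP P e)) (ℤP.+-inverseˡ (coeff P e)))

  negP-inverseʳ : ∀ P → P +P negP P ≈ 0P
  negP-inverseʳ P = ≈-trans (+P-comm P (negP P)) (negP-inverseˡ P)

  *P-assoc : ∀ P Q R → (P *P Q) *P R ≈ P *P (Q *P R)
  *P-assoc P Q R = coeff-≡⇒≈ λ e → begin
    coeff ((P *P Q) *P R) e
      ≡⟨ coeff-*P (P *P Q) R e ⟩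
    ⟪ P *P Q , (λ a → ⟪ R , (λ c → indicator e (a ⊕ c)) ⟫) ⟫
      ≡⟨ ⟪*P⟫ P Q _ ⟩
    ⟪ P , (λ a → ⟪ Q , (λ b → ⟪ R , (λ c → indicator e ((a ⊕ b) ⊕ c)) ⟫) ⟫) ⟫
      ≡⟨ ⟪⟫-cong P (λ a → ⟪⟫-cong Q (λ b →
        ⟪⟫-cong R (λ c → cong (indicator e) (⊕-assoc a b c)))) ⟩
    ⟪ P , (λ a → ⟪ Q , (λ b → ⟪ R , (λ c → indicator e (a ⊕ (b ⊕ c))) ⟫) ⟫) ⟫
      ≡⟨ ⟪⟫-cong P (λ a → sym (⟪*P⟫ Q R _)) ⟩
    ⟪ P , (λ a → ⟪ Q *P R , (λ d → indicator e (a ⊕ d)) ⟫) ⟫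
      ≡⟨ sym (coeff-*P P (Q *P R) e) ⟩
    coeff (P *P (Q *P R)) e ∎
    where open ≡-Reasoning

  *P-comm : ∀ P Q → P *P Q ≈ Q *P P
  *P-comm P Q = coeff-≡⇒≈ λ e → begin
    coeff (P *P Q) e
      ≡⟨ coeff-*P P Q e ⟩
    ⟪ P , (λ a → ⟪ Q , (λ b → indicator e (a ⊕ b)) ⟫) ⟫
      ≡⟨ ⟪⟫-comm P Q _ ⟩
    ⟪ Q , (λ b → ⟪ P , (λ a → indicator e (a ⊕ b)) ⟫) ⟫
      ≡⟨ ⟪⟫-cong Q (λ b → ⟪⟫-cong P (λ a → cong (indicator e) (⊕-comm a b))) ⟩
    ⟪ Q , (λ b → ⟪ P , (λ a → indicator e (b ⊕ a)) ⟫) ⟫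
      ≡⟨ sym (coeff-*P Q P e) ⟩
    coeff (Q *P P) e ∎
    where open ≡-Reasoning

  *P-identityˡ : ∀ P → 1P *P P ≈ P
  *P-identityˡ P = coeff-≡⇒≈ λ e → begin
    coeff (1P *P P) e
      ≡⟨ coeff-*P 1P P e ⟩
    + 1 * ⟪ P , (λ b → indicator e (Vec.replicate n 0 ⊕ b)) ⟫ + + 0
      ≡⟨ ℤP.+-identityʳ _ ⟩
    + 1 * ⟪ P , (λ b → indicator e (Vec.replicate n 0 ⊕ b)) ⟫
      ≡⟨ ℤP.*-identityˡ _ ⟩
    ⟪ P , (λ b → indicator e (Vec.replicate n 0 ⊕ b)) ⟫
      ≡⟨ ⟪⟫-cong P (λ b → cong (indicator e) (⊕-identityˡ b)) ⟩
    ⟪ P , indicator e ⟫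
      ≡⟨ sym (coeff≡⟪indicator⟫ P e) ⟩
    coeff P e ∎
    where open ≡-Reasoning

  *P-distribˡ : ∀ P Q R → P *P (Q +P R) ≈ (P *P Q) +P (P *P R)
  *P-distribˡ P Q R = coeff-≡⇒≈ λ e → begin
    coeff (P *P (Q +P R)) e
      ≡⟨ coeff-*P P (Q +P R) e ⟩
    ⟪ P , (λ a → ⟪ Q ++ R , (λ b → indicator e (a ⊕ b)) ⟫) ⟫
      ≡⟨ ⟪⟫-cong P (λ a → ⟪⟫-++ Q R _) ⟩
    ⟪ P , (λ a → ⟪ Q , _ ⟫ + ⟪ R , _ ⟫) ⟫
      ≡⟨ ⟪⟫-distrib-+ P _ _ ⟩
    ⟪ P , _ ⟫ + ⟪ P , _ ⟫
      ≡⟨ sym (cong₂ _+_ (coeff-*P P Q e) (coeff-*P P R e)) ⟩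
    coeff (P *P Q) e + coeff (P *P R) e
      ≡⟨ sym (coeff-++ (P *P Q) (P *P R) e) ⟩
    coeff ((P *P Q) +P (P *P R)) e ∎
    where open ≡-Reasoning

  polynomialRing : CommutativeRing 0ℓ 0ℓ
  polynomialRing = record
    { Carrier = Poly n
    ; _≈_ = _≈_
    ; _+_ = _+P_
    ; _*_ = _*P_
    ; -_ = negP
    ; 0# = 0P
    ; 1# = 1P
    ; isCommutativeRing = isCommutativeRing
    }
    where
    isCommutativeRing : IsCommutativeRing _≈_ _+P_ _*P_ negP 0P 1P
    isCommutativeRing = record
      { isRing = record
        { +-isAbelianGroup = record
          { isGroup = record
            { isMonoid = record
              { isSemigroup = record
                { isMagma = record
                  { isEquivalence = record { refl = ≈-refl ; sym = ≈-sym ; trans = ≈-trans }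
                  ; ∙-cong = +P-cong }
                ; assoc = λ P Q R → coeff-≡⇒≈ (λ e → cong (λ S → coeff S e) (List.++-assoc P Q R)) }
              ; identity = (λ P → ≈-refl)
                         , (λ P → coeff-≡⇒≈ (λ e → cong (λ S → coeff S e) (List.++-identityʳ P))) }
            ; inverse = negP-inverseˡ , negP-inverseʳ
            ; ⁻¹-cong = negP-cong }
          ; comm = +P-comm }
        ; *-cong = *P-cong
        ; *-assoc = *P-assoc
        ; *-identity = *P-identityˡ , λ P → ≈-trans (*P-comm P 1P) (*P-identityˡ P)
        ; distrib = *P-distribˡ , λ P Q R → ≈-trans (*P-comm (Q +P R) P) (≈-trans (*P-distribˡ P Q R)
                                              (+P-cong (*P-comm P Q) (*P-comm P R))) }
      ; *-comm = *P-comm }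

  ≈0P⇒p∣coeff : ∀ {P} → P ≈ 0P → ∀ a → + p ∣ coeff P a
  ≈0P⇒p∣coeff (coeffwise P≡0) a = ≡ₚ0⇒∣ (P≡0 a)

  p∣coeff⇒≈0P : ∀ {P} → (∀ a → + p ∣ coeff P a) → P ≈ 0P
  p∣coeff⇒≈0P p∣P = coeffwise (λ a → ∣⇒≡ₚ0 (p∣P a))

  record Leading (P : Poly n) (m : Mono n) : Set where
    field
      nonvanishing : ¬ + p ∣ coeff P m
      vanishing-above : ∀ a → m <ₗₑₓ a → + p ∣ coeff P a
  open Leading

  leading-among : ∀ P (L : List (Mono n)) → (∀ a → a ∈ L → + p ∣ coeff P a)
                  ⊎ ∃ λ m → ¬ + p ∣ coeff P m × (∀ a → a ∈ L → m <ₗₑₓ a → + p ∣ coeff P a)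
  leading-among P [] = inj₁ (λ _ ())
  leading-among P (x ∷ L) with leading-among P L | + p ∣? coeff P x
  ... | inj₁ p∣L | yes p∣x = inj₁ λ { a (here refl) → p∣x ; a (there a∈L) → p∣L a a∈L }
  ... | inj₁ p∣L | no p∤x = inj₂ (x , p∤x , λ { a (here refl) x<x → ⊥-elim (<ₗₑₓ-irrefl x x<x)
                                               ; a (there a∈L) _ → p∣L a a∈L })
  ... | inj₂ (m , p∤m , above-m) | yes p∣x = inj₂ (m , p∤m , λ { a (here refl) _ → p∣x
                                                                ; a (there a∈L) → above-m a a∈L })
  ... | inj₂ (m , p∤m , above-m) | no p∤x with <ₗₑₓ-cmp m x
  ...   | tri< m<x _ _ = inj₂ (x , p∤x , λ { a (here refl) x<x → ⊥-elim (<ₗₑₓ-irrefl x x<x)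
                                          ; a (there a∈L) x<a → above-m a a∈L (<ₗₑₓ-trans m<x x<a) })
  ...   | tri≈ _ refl _ = inj₂ (m , p∤m , λ { a (here refl) m<m → ⊥-elim (<ₗₑₓ-irrefl m m<m)
                                           ; a (there a∈L) → above-m a a∈L })
  ...   | tri> _ _ x<m = inj₂ (m , p∤m , λ { a (here refl) m<x → ⊥-elim (<ₗₑₓ-irrefl x (<ₗₑₓ-trans x<m m<x))
                                          ; a (there a∈L) → above-m a a∈L })

  coeff-∉ : ∀ (P : Poly n) a → a ∉ List.map proj₂ P → coeff P a ≡ + 0
  coeff-∉ [] a _ = refl
  coeff-∉ ((c , m) ∷ P) a a∉P with ≡-dec ℕ._≟_ m a
  ... | yes m≡a = ⊥-elim (a∉P (here (sym m≡a)))
  ... | no _ = coeff-∉ P a (a∉P ∘ there)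

  p∣coeff-from-∈ : ∀ (P : Poly n) a → (a ∈ List.map proj₂ P → + p ∣ coeff P a) → + p ∣ coeff P a
  p∣coeff-from-∈ P a p∣a with a ∈? List.map proj₂ P
  ... | yes a∈P = p∣a a∈P
  ... | no a∉P = subst (+ p ∣_) (sym (coeff-∉ P a a∉P)) p∣0

  ≈0P⊎leading : ∀ P → P ≈ 0P ⊎ ∃ (Leading P)
  ≈0P⊎leading P with leading-among P (List.map proj₂ P)
  ... | inj₁ p∣P = inj₁ (p∣coeff⇒≈0P (λ a → p∣coeff-from-∈ P a (p∣P a)))
  ... | inj₂ (m , p∤m , above-m) = inj₂ (m , record
    { nonvanishing = p∤m
    ; vanishing-above = λ a m<a → p∣coeff-from-∈ P a (λ a∈P → above-m a a∈P m<a) })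

  ≈0P? : ∀ P → Dec (P ≈ 0P)
  ≈0P? P with ≈0P⊎leading P
  ... | inj₁ P≈0 = yes P≈0
  ... | inj₂ (m , lead) = no (λ P≈0 → nonvanishing lead (≈0P⇒p∣coeff P≈0 m))

  indicator-≢ : ∀ {e a} → a ≢ e → indicator e a ≡ + 0
  indicator-≢ {e} {a} a≢e with ≡-dec ℕ._≟_ a e
  ... | yes a≡e = ⊥-elim (a≢e a≡e)
  ... | no _ = refl

  indicator-refl : ∀ e → indicator e e ≡ + 1
  indicator-refl e with ≡-dec ℕ._≟_ e e
  ... | yes _ = refl
  ... | no e≢e = ⊥-elim (e≢e refl)

  ∣-resp-≡ₚ : ∀ {x y} → x ≡ₚ y → + p ∣ x → + p ∣ y
  ∣-resp-≡ₚ {x} {y} (divides-difference p∣x-y) p∣x = subst (+ p ∣_) (eq x y) (∣m∣n⇒∣m-n p∣x p∣x-y)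
    where eq : ∀ x y → x - (x - y) ≡ y
          eq = solve-∀

  -- With m, m′ the leading monomials of P, Q, the only pair (a , b) with
  -- a ⊕ b = m ⊕ m′ and a nonvanishing contribution is (m , m′).
  coeff-*P-leading : ∀ {P Q m m′} → Leading P m → Leading Q m′ →
                     coeff (P *P Q) (m ⊕ m′) ≡ₚ coeff P m * coeff Q m′
  coeff-*P-leading {P} {Q} {m} {m′} lead-P lead-Q =
    subst (_≡ₚ coeff P m * coeff Q m′) (sym (coeff-*P P Q e))
      (≡ₚ-trans (⟪⟫-single P g m p∣P-off-m) (≡ₚ-*ˡ (coeff P m) g[m]))
    where
    e = m ⊕ m′
    g : Mono n → ℤ
    g a = ⟪ Q , (λ b → indicator e (a ⊕ b)) ⟫
    g-below : ∀ a → a <ₗₑₓ m → + p ∣ g a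
    g-below a a<m = ⟪⟫-vanishing Q _ λ b → p∣term b (≡-dec ℕ._≟_ (a ⊕ b) e)
      where
      p∣term : ∀ b → Dec (a ⊕ b ≡ e) → + p ∣ coeff Q b * indicator e (a ⊕ b)
      p∣term b (yes a⊕b≡e) = ∣m⇒∣m*n _ (vanishing-above lead-Q b (<ₗₑₓ-⊕-exchange a<m a⊕b≡e))
      p∣term b (no a⊕b≢e) rewrite indicator-≢ a⊕b≢e | ℤP.*-zeroʳ (coeff Q b) = p∣0
    g[m] : g m ≡ₚ coeff Q m′
    g[m] = ≡ₚ-trans (⟪⟫-single Q _ m′ p∣Q-off-m′)
                    (≡⇒≡ₚ (trans (cong (coeff Q m′ *_) (indicator-refl e)) (ℤP.*-identityʳ _)))
      where
      p∣Q-off-m′ : ∀ b → b ≢ m′ → + p ∣ coeff Q b * indicator e (m ⊕ b)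
      p∣Q-off-m′ b b≢m′
        rewrite indicator-≢ {e} {m ⊕ b} (b≢m′ ∘ ⊕-cancelˡ m b m′) | ℤP.*-zeroʳ (coeff Q b) = p∣0
    p∣P-off-m : ∀ a → a ≢ m → + p ∣ coeff P a * g a
    p∣P-off-m a a≢m with <ₗₑₓ-cmp a m
    ... | tri< a<m _ _ = ∣n⇒∣m*n (coeff P a) (g-below a a<m)
    ... | tri≈ _ a≡m _ = ⊥-elim (a≢m a≡m)
    ... | tri> _ _ m<a = ∣m⇒∣m*n (g a) (vanishing-above lead-P a m<a)

  module _ (p-prime : Prime p) where

    p∣*⇒p∣⊎p∣ : ∀ x y → + p ∣ x * y → + p ∣ x ⊎ + p ∣ y
    p∣*⇒p∣⊎p∣ x y p∣xy
      with euclidsLemma Int.∣ x ∣ Int.∣ y ∣ p-prime (subst (p ℕD.∣_) (ℤP.abs-* x y) (∣⇒∣ᵤ p∣xy))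
    ... | inj₁ p∣x = inj₁ (∣ᵤ⇒∣ p∣x)
    ... | inj₂ p∣y = inj₂ (∣ᵤ⇒∣ p∣y)

    p∤coeff-*P-leading : ∀ {P Q m m′} → Leading P m → Leading Q m′ → ¬ + p ∣ coeff (P *P Q) (m ⊕ m′)
    p∤coeff-*P-leading lead-P lead-Q p∣PQ = Sum.[ nonvanishing lead-P , nonvanishing lead-Q ]
      (p∣*⇒p∣⊎p∣ _ _ (∣-resp-≡ₚ (coeff-*P-leading lead-P lead-Q) p∣PQ))

    *P-≉0P : ∀ {P Q} → ¬ P ≈ 0P → ¬ Q ≈ 0P → ¬ (P *P Q) ≈ 0P
    *P-≉0P {P} {Q} P≉0 Q≉0 PQ≈0 with ≈0P⊎leading P | ≈0P⊎leading Q
    ... | inj₁ P≈0 | _ = P≉0 P≈0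
    ... | inj₂ _ | inj₁ Q≈0 = Q≉0 Q≈0
    ... | inj₂ (m , lead-P) | inj₂ (m′ , lead-Q) =
      p∤coeff-*P-leading lead-P lead-Q (≈0P⇒p∣coeff PQ≈0 (m ⊕ m′))

    1P≉0P : ¬ 1P ≈ 0P
    1P≉0P 1P≈0 = ¬prime[1] (subst Prime (ℕD.∣1⇒≡1 (∣⇒∣ᵤ p∣1)) p-prime)
      where
      coeff-1P : coeff (1P {n}) (Vec.replicate n 0) ≡ + 1
      coeff-1P = trans (coeff≡⟪indicator⟫ 1P _)
                       (cong (λ x → + 1 * x + + 0) (indicator-refl (Vec.replicate n 0)))
      p∣1 : + p ∣ + 1
      p∣1 = subst (+ p ∣_) coeff-1P (≈0P⇒p∣coeff 1P≈0 (Vec.replicate n 0))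

    isDiscreteDomain : IsDiscreteDomain polynomialRing
    isDiscreteDomain = record { _≈0? = ≈0P? ; *-≉0 = *P-≉0P ; 1≉0 = 1P≉0P }

module LinearAlgebra {c ℓ} (F : DiscreteField c ℓ) where
  open DiscreteField F
  open CommutativeRing commutativeRing
  open RingProperties ring using (-‿distribˡ-*; -‿distribʳ-*; +-inverseˡ-unique; -1*x≈-x)
  open SemiringSum semiring
    using (sum; sum-cong-≋; ∑-distrib-+; sum-remove; *-distribˡ-sum; *-distribʳ-sum; sum-replicate-zero)
  open NaturalCoefficients commutativeSemiring using (solve; _:=_; _:+_; _:*_)
  module ≈-Reasoning = Relation.Binary.Reasoning.Setoid setoid

  sum-zero : ∀ {N} (f : Fin N → Carrier) → (∀ j → f j ≈ 0#) → sum f ≈ 0#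
  sum-zero {N} f f≈0 = trans (sum-cong-≋ f≈0) (sum-replicate-zero N)

  Vector : ℕ → Set c
  Vector d = Fin d → Carrier

  infix 4 _≈ᵛ_
  record _≈ᵛ_ {d} (u v : Vector d) : Set ℓ where
    constructor pointwise
    field at : ∀ i → u i ≈ v i
  open _≈ᵛ_ public

  ≈ᵛ-setoid : ℕ → Setoid c ℓ
  ≈ᵛ-setoid d = record
    { Carrier = Vector d
    ; _≈_ = _≈ᵛ_
    ; isEquivalence = record
      { refl = pointwise (λ _ → refl)
      ; sym = λ (pointwise u≈v) → pointwise (λ i → sym (u≈v i))
      ; trans = λ (pointwise u≈v) (pointwise v≈w) → pointwise (λ i → trans (u≈v i) (v≈w i))
      }
    }

  module _ {d : ℕ} where
    open Setoid (≈ᵛ-setoid d) public using () renaming (refl to ≈ᵛ-refl; sym to ≈ᵛ-sym; trans to ≈ᵛ-trans)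

  module ≈ᵛ-Reasoning {d} = Relation.Binary.Reasoning.Setoid (≈ᵛ-setoid d)

  infixl 6 _+ᵛ_ _-ᵛ_
  infixl 7 _·ᵛ_
  infix 8 -ᵛ_

  _+ᵛ_ _-ᵛ_ : ∀ {d} → Vector d → Vector d → Vector d
  (u +ᵛ v) i = u i + v i
  (u -ᵛ v) i = u i - v i

  -ᵛ_ : ∀ {d} → Vector d → Vector d
  (-ᵛ v) i = - v i

  _·ᵛ_ : ∀ {d} → Carrier → Vector d → Vector d
  (a ·ᵛ v) i = a * v i

  0ᵛ : ∀ {d} → Vector d
  0ᵛ i = 0#

  +ᵛ-cong : ∀ {d} {u u′ v v′ : Vector d} → u ≈ᵛ u′ → v ≈ᵛ v′ → u +ᵛ v ≈ᵛ u′ +ᵛ v′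
  +ᵛ-cong (pointwise u≈u′) (pointwise v≈v′) = pointwise (λ i → +-cong (u≈u′ i) (v≈v′ i))

  -ᵛ-cong : ∀ {d} {u u′ v v′ : Vector d} → u ≈ᵛ u′ → v ≈ᵛ v′ → u -ᵛ v ≈ᵛ u′ -ᵛ v′
  -ᵛ-cong (pointwise u≈u′) (pointwise v≈v′) = pointwise (λ i → +-cong (u≈u′ i) (-‿cong (v≈v′ i)))

  ·ᵛ-congˡ : ∀ {d} a {u v : Vector d} → u ≈ᵛ v → a ·ᵛ u ≈ᵛ a ·ᵛ v
  ·ᵛ-congˡ a (pointwise u≈v) = pointwise (λ i → *-congˡ (u≈v i))

  Op : ℕ → Set c
  Op d = Vector d → Vector d

  Congruent : ∀ {d} → Op d → Set (c ⊔ ℓ)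
  Congruent f = ∀ {u v} → u ≈ᵛ v → f u ≈ᵛ f v

  record IsLinear {d} (f : Op d) : Set (c ⊔ ℓ) where
    field
      cong : Congruent f
      +-homo : ∀ u v → f (u +ᵛ v) ≈ᵛ f u +ᵛ f v
      ·-homo : ∀ a v → f (a ·ᵛ v) ≈ᵛ a ·ᵛ f v

    0-homo : f 0ᵛ ≈ᵛ 0ᵛ
    0-homo = ≈ᵛ-trans (cong (pointwise (λ _ → sym (zeroˡ 0#))))
               (≈ᵛ-trans (·-homo 0# 0ᵛ) (pointwise (λ _ → zeroˡ _)))

    -‿homo : ∀ v → f (-ᵛ v) ≈ᵛ -ᵛ f v
    -‿homo v = ≈ᵛ-trans (cong (pointwise λ i → sym (-1*x≈-x (v i))))
                 (≈ᵛ-trans (·-homo (- 1#) v) (pointwise λ i → -1*x≈-x _))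

    -‿homo₂ : ∀ u v → f (u -ᵛ v) ≈ᵛ f u -ᵛ f v
    -‿homo₂ u v = ≈ᵛ-trans (+-homo u (-ᵛ v)) (+ᵛ-cong ≈ᵛ-refl (-‿homo v))
  open IsLinear public

  Commute : ∀ {d} → Op d → Op d → Set (c ⊔ ℓ)
  Commute f g = ∀ v → f (g v) ≈ᵛ g (f v)

  Bicommutes : ∀ {d} → Op d → Op d → Set (c ⊔ ℓ)
  Bicommutes f h = ∀ g → IsLinear g → Commute g f → Commute g h

  id-isLinear : ∀ {d} → IsLinear {d} id
  id-isLinear = record { cong = id ; +-homo = λ _ _ → ≈ᵛ-refl ; ·-homo = λ _ _ → ≈ᵛ-refl }

  ∘-isLinear : ∀ {d} {f g : Op d} → IsLinear f → IsLinear g → IsLinear (f ∘ g)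
  ∘-isLinear f-lin g-lin = record
    { cong = cong f-lin ∘ cong g-lin
    ; +-homo = λ u v → ≈ᵛ-trans (cong f-lin (+-homo g-lin u v)) (+-homo f-lin _ _)
    ; ·-homo = λ a v → ≈ᵛ-trans (cong f-lin (·-homo g-lin a v)) (·-homo f-lin a _)
    }

  infixr 8 _^_
  _^_ : ∀ {d} → Op d → ℕ → Op d
  (f ^ zero) v = v
  (f ^ suc m) v = f ((f ^ m) v)

  ^-cong : ∀ {d} {f : Op d} → Congruent f → ∀ m → Congruent (f ^ m)
  ^-cong f-cong zero = id
  ^-cong f-cong (suc m) = f-cong ∘ ^-cong f-cong m

  ^-isLinear : ∀ {d} {f : Op d} → IsLinear f → ∀ m → IsLinear (f ^ m)
  ^-isLinear f-lin zero = id-isLinear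
  ^-isLinear f-lin (suc m) = ∘-isLinear f-lin (^-isLinear f-lin m)

  ^-+ : ∀ {d} (f : Op d) m k v → (f ^ (m ℕ.+ k)) v ≡.≡ (f ^ m) ((f ^ k) v)
  ^-+ f zero k v = ≡.refl
  ^-+ f (suc m) k v = ≡.cong f (^-+ f m k v)

  commute-^ : ∀ {d} {f g : Op d} → Congruent g → Congruent f → Commute g f → ∀ m → Commute g (f ^ m)
  commute-^ g-cong f-cong g∘f≈f∘g zero v = ≈ᵛ-refl
  commute-^ g-cong f-cong g∘f≈f∘g (suc m) v =
    ≈ᵛ-trans (g∘f≈f∘g _) (f-cong (commute-^ g-cong f-cong g∘f≈f∘g m v))

  ^-commute : ∀ {d} {f : Op d} → IsLinear f → ∀ m → Commute f (f ^ m)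
  ^-commute f-lin = commute-^ (cong f-lin) (cong f-lin) (λ _ → ≈ᵛ-refl)

  Matrix : ℕ → Set c
  Matrix d = Fin d → Fin d → Carrier

  ⟦_⟧ : ∀ {d} → Matrix d → Op d
  ⟦ A ⟧ v i = sum (λ j → A i j * v j)

  ⟦⟧-isLinear : ∀ {d} (A : Matrix d) → IsLinear ⟦ A ⟧
  ⟦⟧-isLinear A = record
    { cong = λ (pointwise u≈v) → pointwise λ i → sum-cong-≋ (λ j → *-congˡ (u≈v j))
    ; +-homo = λ u v → pointwise λ i →
        trans (sum-cong-≋ (λ j → distribˡ (A i j) (u j) (v j)))
              (∑-distrib-+ (λ j → A i j * u j) (λ j → A i j * v j))
    ; ·-homo = λ a v → pointwise λ i →
        trans (sum-cong-≋ (λ j → solve 3 (λ x a y → x :* (a :* y) := a :* (x :* y)) refl (A i j) a (v j)))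
              (sym (*-distribˡ-sum a (λ j → A i j * v j)))
    }

  ∑ᵛ : ∀ {N d} → (Fin N → Vector d) → Vector d
  ∑ᵛ w i = sum (λ j → w j i)

  ∑ᵛ-cong : ∀ {N d} {w w′ : Fin N → Vector d} → (∀ j → w j ≈ᵛ w′ j) → ∑ᵛ w ≈ᵛ ∑ᵛ w′
  ∑ᵛ-cong w≈w′ = pointwise λ i → sum-cong-≋ (λ j → at (w≈w′ j) i)

  ∑ᵛ-homo : ∀ {N d} {f : Op d} → IsLinear f → (w : Fin N → Vector d) → f (∑ᵛ w) ≈ᵛ ∑ᵛ (f ∘ w)
  ∑ᵛ-homo {zero} f-lin w = 0-homo f-lin
  ∑ᵛ-homo {suc N} f-lin w =
    ≈ᵛ-trans (+-homo f-lin (w fzero) (∑ᵛ (w ∘ fsuc))) (+ᵛ-cong ≈ᵛ-refl (∑ᵛ-homo f-lin (w ∘ fsuc)))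

  δ : ∀ {d} → Fin d → Fin d → Carrier
  δ s t with s Fin.≟ t
  ... | yes _ = 1#
  ... | no _ = 0#

  ∑-δ : ∀ {d} (x : Vector d) t → sum (λ s → x s * δ s t) ≈ x t
  ∑-δ {suc d} x t = begin
    sum (λ s → x s * δ s t)
      ≈⟨ sum-remove {i = t} (λ s → x s * δ s t) ⟩
    x t * δ t t + sum (λ j → x (punchIn t j) * δ (punchIn t j) t)
      ≈⟨ +-cong (*-congˡ δ-diag) (sum-zero _ (λ j → trans (*-congˡ (δ-off j)) (zeroʳ _))) ⟩
    x t * 1# + 0#
      ≈⟨ trans (+-identityʳ _) (*-identityʳ _) ⟩
    x t ∎
    where
    open ≈-Reasoning
    δ-diag : δ t t ≈ 1#
    δ-diag with t Fin.≟ t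
    ... | yes _ = refl
    ... | no t≢t = ⊥-elim (t≢t ≡.refl)
    δ-off : ∀ j → δ (punchIn t j) t ≈ 0#
    δ-off j with punchIn t j Fin.≟ t
    ... | yes πj≡t = ⊥-elim (FinP.punchInᵢ≢i t j πj≡t)
    ... | no _ = refl

  basis-expansion : ∀ {d} (v : Vector d) → v ≈ᵛ ∑ᵛ (λ s → v s ·ᵛ δ s)
  basis-expansion v = pointwise λ t → sym (∑-δ v t)

  vanishes-on-basis : ∀ {d} {f : Op d} → IsLinear f → (∀ s → f (δ s) ≈ᵛ 0ᵛ) → ∀ v → f v ≈ᵛ 0ᵛ
  vanishes-on-basis {f = f} f-lin f[δ]≈0 v = begin
    f v
      ≈⟨ cong f-lin (basis-expansion v) ⟩
    f (∑ᵛ (λ s → v s ·ᵛ δ s))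
      ≈⟨ ∑ᵛ-homo f-lin (λ s → v s ·ᵛ δ s) ⟩
    ∑ᵛ (λ s → f (v s ·ᵛ δ s))
      ≈⟨ ∑ᵛ-cong (λ s → ≈ᵛ-trans (·-homo f-lin (v s) (δ s)) (·ᵛ-congˡ (v s) (f[δ]≈0 s))) ⟩
    ∑ᵛ (λ s → v s ·ᵛ 0ᵛ)
      ≈⟨ pointwise (λ i → sum-zero _ (λ s → zeroʳ (v s))) ⟩
    0ᵛ ∎
    where open ≈ᵛ-Reasoning

  poly : ∀ {d D} → Op d → (Fin D → Carrier) → Op d
  poly f a v = ∑ᵛ (λ j → a j ·ᵛ (f ^ Fin.toℕ j) v)

  poly-isLinear : ∀ {d D} {f : Op d} → IsLinear f → (a : Fin D → Carrier) → IsLinear (poly f a)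
  poly-isLinear {f = f} f-lin a = record
    { cong = λ u≈v → ∑ᵛ-cong (λ j → ·ᵛ-congˡ (a j) (cong (f^ j) u≈v))
    ; +-homo = λ u v → pointwise λ i →
        trans (sum-cong-≋ (λ j → trans (*-congˡ (at (+-homo (f^ j) u v) i)) (distribˡ (a j) _ _)))
              (∑-distrib-+ (λ j → a j * (f ^ Fin.toℕ j) u i) (λ j → a j * (f ^ Fin.toℕ j) v i))
    ; ·-homo = λ b v → pointwise λ i →
        trans (sum-cong-≋ (λ j → trans (*-congˡ (at (·-homo (f^ j) b v) i))
                                       (solve 3 (λ x b y → x :* (b :* y) := b :* (x :* y)) refl (a j) b _)))
              (sym (*-distribˡ-sum b (λ j → a j * (f ^ Fin.toℕ j) v i)))
    }
    where
    f^ : ∀ {D} (j : Fin D) → IsLinear (f ^ Fin.toℕ j)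
    f^ j = ^-isLinear f-lin (Fin.toℕ j)

  poly-bicommutes : ∀ {d D} {f : Op d} → IsLinear f → (a : Fin D → Carrier) → Bicommutes f (poly f a)
  poly-bicommutes {f = f} f-lin a g g-lin g∘f≈f∘g v = begin
    g (poly f a v)
      ≈⟨ ∑ᵛ-homo g-lin (λ j → a j ·ᵛ (f ^ Fin.toℕ j) v) ⟩
    ∑ᵛ (λ j → g (a j ·ᵛ (f ^ Fin.toℕ j) v))
      ≈⟨ ∑ᵛ-cong (λ j → ≈ᵛ-trans (·-homo g-lin (a j) _)
        (·ᵛ-congˡ (a j) (commute-^ (cong g-lin) (cong f-lin) g∘f≈f∘g (Fin.toℕ j) v))) ⟩
    poly f a (g v) ∎
    where open ≈ᵛ-Reasoning

  record LinearRelation {N m} (w : Fin N → Vector m) : Set (c ⊔ ℓ) where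
    field
      coefficient : Fin N → Carrier
      nontrivial : ∃ λ j → ¬ coefficient j ≈ 0#
      relation : ∀ r → sum (λ j → coefficient j * w j r) ≈ 0#
  open LinearRelation

  pivot : ∀ {N} (x : Fin (suc N) → Carrier) → Σ (Fin (suc N)) λ k → Σ (Fin N → Carrier) λ μ →
          ∀ j → x (punchIn k j) + μ j * x k ≈ 0#
  pivot x with FinP.any? (λ k → ¬? (x k ≈0?))
  ... | yes (k , xₖ≉0) = k , (λ j → - (x (punchIn k j) * xₖ⁻¹)) , λ j → begin
    x (punchIn k j) + - (x (punchIn k j) * xₖ⁻¹) * x k
      ≈⟨ +-congˡ (-‿distribˡ-* _ (x k)) ⟨
    x (punchIn k j) + - (x (punchIn k j) * xₖ⁻¹ * x k)
      ≈⟨ +-congˡ (-‿cong (solve 3 (λ y i z → y :* i :* z := y :* (z :* i)) refl _ xₖ⁻¹ (x k))) ⟩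
    x (punchIn k j) + - (x (punchIn k j) * (x k * xₖ⁻¹))
      ≈⟨ +-congˡ (-‿cong (trans (*-congˡ (inverseʳ (x k) xₖ≉0)) (*-identityʳ _))) ⟩
    x (punchIn k j) + - x (punchIn k j)
      ≈⟨ -‿inverseʳ _ ⟩
    0# ∎
    where
    open ≈-Reasoning
    xₖ⁻¹ = inverse (x k) xₖ≉0
  ... | no ∄k = fzero , (λ _ → 0#) , λ j → trans (+-cong (x≈0 (fsuc j)) (zeroˡ (x fzero))) (+-identityʳ 0#)
    where
    x≈0 : ∀ k → x k ≈ 0#
    x≈0 k = decidable-stable (x k ≈0?) (λ xₖ≉0 → ∄k (k , xₖ≉0))

  -- Lifts a relation among the eliminated vectors x (punchIn k j) + μ j * x k to one among the x i.
  insertAt-relation : ∀ {N} (a μ : Fin N → Carrier) k (x : Fin (suc N) → Carrier) →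
                      sum (λ i → insertAt a k (sum (λ j → a j * μ j)) i * x i)
                      ≈ sum (λ j → a j * (x (punchIn k j) + μ j * x k))
  insertAt-relation a μ k x = begin
    sum (λ i → b i * x i)
      ≈⟨ sum-remove {i = k} (λ i → b i * x i) ⟩
    b k * x k + sum (λ j → b (punchIn k j) * x (punchIn k j))
      ≈⟨ +-cong (*-congʳ (reflexive (insertAt-lookup a k S)))
        (sum-cong-≋ (λ j → *-congʳ (reflexive (insertAt-punchIn a k S j)))) ⟩
    S * x k + sum (λ j → a j * x (punchIn k j))
      ≈⟨ +-congʳ (*-distribʳ-sum (x k) (λ j → a j * μ j)) ⟩
    sum (λ j → a j * μ j * x k) + sum (λ j → a j * x (punchIn k j))
      ≈⟨ +-comm _ _ ⟩
    sum (λ j → a j * x (punchIn k j)) + sum (λ j → a j * μ j * x k)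
      ≈⟨ ∑-distrib-+ (λ j → a j * x (punchIn k j)) (λ j → a j * μ j * x k) ⟨
    sum (λ j → a j * x (punchIn k j) + a j * μ j * x k)
      ≈⟨ sum-cong-≋ (λ j → solve 4 (λ a y m z → a :* y :+ a :* m :* z := a :* (y :+ m :* z))
        refl (a j) (x (punchIn k j)) (μ j) (x k)) ⟩
    sum (λ j → a j * (x (punchIn k j) + μ j * x k)) ∎
    where
    open ≈-Reasoning
    S = sum (λ j → a j * μ j)
    b = insertAt a k S

  linearlyDependent : ∀ m (w : Fin (suc m) → Vector m) → LinearRelation w
  linearlyDependent zero w = record { coefficient = λ _ → 1# ; nontrivial = fzero , 1≉0 ; relation = λ () }
  linearlyDependent (suc m) w with pivot (λ i → w i fzero)
  ... | k , μ , eliminated = record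
    { coefficient = insertAt a k (sum (λ j → a j * μ j))
    ; nontrivial = punchIn k j₀ , λ b≈0 → aⱼ₀≉0 (trans (reflexive (≡.sym (insertAt-punchIn a k _ j₀))) b≈0)
    ; relation = λ r → trans (insertAt-relation a μ k (λ i → w i r)) (relation′ r)
    }
    where
    u : Fin (suc m) → Vector (suc m)
    u j r = w (punchIn k j) r + μ j * w k r
    R : LinearRelation (λ j r → u j (fsuc r))
    R = linearlyDependent m (λ j r → u j (fsuc r))
    a : Fin (suc m) → Carrier
    a = coefficient R
    j₀ = proj₁ (nontrivial R)
    aⱼ₀≉0 = proj₂ (nontrivial R)
    relation′ : ∀ r → sum (λ j → a j * u j r) ≈ 0#
    relation′ fzero = sum-zero (λ j → a j * u j fzero) (λ j → trans (*-congˡ (eliminated j)) (zeroʳ (a j)))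
    relation′ (fsuc r) = relation R r

  -- f⁰, …, f^(d*d), read as vectors of length d * d through their values on the basis, are dependent.
  annihilatingPolynomial : ∀ {d} {f : Op d} → IsLinear f →
                           Σ (Fin (suc (d ℕ.* d)) → Carrier) λ a →
                             (∃ λ j → ¬ a j ≈ 0#) × (∀ v → poly f a v ≈ᵛ 0ᵛ)
  annihilatingPolynomial {d} {f} f-lin =
    coefficient R , nontrivial R , vanishes-on-basis (poly-isLinear f-lin (coefficient R)) poly[δ]≈0
    where
    flatten : Op d → Vector (d ℕ.* d)
    flatten g r = let (s , t) = Fin.remQuot {d} d r in g (δ s) t
    R : LinearRelation (λ j → flatten (f ^ Fin.toℕ j))
    R = linearlyDependent (d ℕ.* d) (λ j → flatten (f ^ Fin.toℕ j))
    poly[δ]≈0 : ∀ s → poly f (coefficient R) (δ s) ≈ᵛ 0ᵛ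
    poly[δ]≈0 s = pointwise λ t →
      ≡.subst (λ (s , t) → sum (λ j → coefficient R j * (f ^ Fin.toℕ j) (δ s) t) ≈ 0#)
              (FinP.remQuot-combine s t) (relation R (Fin.combine s t))

  poly-suc : ∀ {d D} {f : Op d} → IsLinear f → (a : Fin (suc D) → Carrier) → ∀ v →
             poly f a v ≈ᵛ a fzero ·ᵛ v +ᵛ poly f (a ∘ fsuc) (f v)
  poly-suc f-lin a v =
    +ᵛ-cong ≈ᵛ-refl (∑ᵛ-cong (λ j → ·ᵛ-congˡ (a (fsuc j)) (^-commute f-lin (Fin.toℕ j) v)))

  record PseudoInverse {d} (f : Op d) (k : ℕ) : Set (c ⊔ ℓ) where
    field
      h : Op d
      h-cong : Congruent h
      h-bicommutes : Bicommutes f h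
      f^k≈f^k+1∘h : ∀ v → (f ^ k) v ≈ᵛ (f ^ suc k) (h v)

  raise-index : ∀ {d k} {f : Op d} → IsLinear f → PseudoInverse f k → ∀ j → PseudoInverse f (j ℕ.+ k)
  raise-index {k = k} {f} f-lin f⁺ j = record
    { h = h ; h-cong = h-cong ; h-bicommutes = h-bicommutes
    ; f^k≈f^k+1∘h = λ v →
        ≡.subst₂ _≈ᵛ_ (≡.sym (^-+ f j k v))
                      (≡.trans (≡.sym (^-+ f j (suc k) (h v))) (≡.cong (λ i → (f ^ i) (h v)) (ℕP.+-suc j k)))
                      (cong (^-isLinear f-lin j) (f^k≈f^k+1∘h v))
    }
    where open PseudoInverse f⁺

  solve-linear : ∀ {a x y} (a≉0 : ¬ a ≈ 0#) → a * x + y ≈ 0# → x ≈ - inverse a a≉0 * y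
  solve-linear {a} {x} {y} a≉0 ax+y≈0 = begin
    x               ≈⟨ *-identityˡ x ⟨
    1# * x          ≈⟨ *-congʳ (trans (*-comm a⁻¹ a) (inverseʳ a a≉0)) ⟨
    a⁻¹ * a * x     ≈⟨ *-assoc a⁻¹ a x ⟩
    a⁻¹ * (a * x)   ≈⟨ *-congˡ (+-inverseˡ-unique (a * x) y ax+y≈0) ⟩
    a⁻¹ * - y       ≈⟨ -‿distribʳ-* a⁻¹ y ⟨
    - (a⁻¹ * y)     ≈⟨ -‿distribˡ-* a⁻¹ y ⟩
    - a⁻¹ * y       ∎
    where
    open ≈-Reasoning
    a⁻¹ = inverse a a≉0

  -- Write a = (0, …, 0, aⱼ, …) with aⱼ ≉ 0: then f^(k+j) = f^(k+j+1) ∘ h, where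
  -- h = - aⱼ⁻¹ (aⱼ₊₁ + aⱼ₊₂ f + ⋯).
  pseudoInverse-from-poly : ∀ {d D} {f : Op d} → IsLinear f → (a : Fin D → Carrier) → (∃ λ j → ¬ a j ≈ 0#) →
                            ∀ k → (∀ v → poly f a ((f ^ k) v) ≈ᵛ 0ᵛ) →
                            Σ ℕ λ k′ → k′ ℕ.< k ℕ.+ D × PseudoInverse f k′
  pseudoInverse-from-poly {D = zero} f-lin a (() , _) k a[f^k]≈0
  pseudoInverse-from-poly {D = suc D} {f} f-lin a nonzero k a[f^k]≈0 with a fzero ≈0?
  ... | no a₀≉0 = k , ℕP.m<m+n k ℕ.z<s , record
    { h = h
    ; h-cong = ·ᵛ-congˡ κ ∘ cong (poly-isLinear f-lin b)
    ; h-bicommutes = λ g g-lin g∘f≈f∘g v →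
        ≈ᵛ-trans (·-homo g-lin κ (poly f b v)) (·ᵛ-congˡ κ (poly-bicommutes f-lin b g g-lin g∘f≈f∘g v))
    ; f^k≈f^k+1∘h = λ v → pointwise λ i →
        trans (solve-linear a₀≉0 (at (a[f^k]-expanded v) i)) (sym (at (·-homo f^k+1-lin κ (poly f b v)) i))
    }
    where
    open ≈ᵛ-Reasoning
    b : Fin D → Carrier
    b = a ∘ fsuc
    κ : Carrier
    κ = - inverse (a fzero) a₀≉0
    h : Op _
    h v = κ ·ᵛ poly f b v
    f^k+1-lin : IsLinear (f ^ suc k)
    f^k+1-lin = ^-isLinear f-lin (suc k)
    a[f^k]-expanded : ∀ v → a fzero ·ᵛ (f ^ k) v +ᵛ (f ^ suc k) (poly f b v) ≈ᵛ 0ᵛ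
    a[f^k]-expanded v = begin
      a fzero ·ᵛ (f ^ k) v +ᵛ (f ^ suc k) (poly f b v)
        ≈⟨ +ᵛ-cong ≈ᵛ-refl (poly-bicommutes f-lin b (f ^ suc k) f^k+1-lin
          (λ w → ≈ᵛ-sym (^-commute f-lin (suc k) w)) v) ⟩
      a fzero ·ᵛ (f ^ k) v +ᵛ poly f b ((f ^ suc k) v)
        ≈⟨ poly-suc f-lin a ((f ^ k) v) ⟨
      poly f a ((f ^ k) v)
        ≈⟨ a[f^k]≈0 v ⟩
      0ᵛ ∎
  ... | yes a₀≈0 with nonzero
  ...   | fzero , a₀≉0 = ⊥-elim (a₀≉0 a₀≈0)
  ...   | fsuc j , aⱼ≉0 with pseudoInverse-from-poly f-lin (a ∘ fsuc) (j , aⱼ≉0) (suc k) b[f^k+1]≈0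
    where
    open ≈ᵛ-Reasoning
    b[f^k+1]≈0 : ∀ v → poly f (a ∘ fsuc) ((f ^ suc k) v) ≈ᵛ 0ᵛ
    b[f^k+1]≈0 v = begin
      poly f (a ∘ fsuc) ((f ^ suc k) v)
        ≈⟨ pointwise (λ i → trans (+-congʳ (trans (*-congʳ a₀≈0) (zeroˡ _))) (+-identityˡ _)) ⟨
      a fzero ·ᵛ (f ^ k) v +ᵛ poly f (a ∘ fsuc) ((f ^ suc k) v)
        ≈⟨ poly-suc f-lin a ((f ^ k) v) ⟨
      poly f a ((f ^ k) v)
        ≈⟨ a[f^k]≈0 v ⟩
      0ᵛ ∎
  ...     | k′ , k′<1+k+D , f⁺ = k′ , ≡.subst (k′ ℕ.<_) (≡.sym (ℕP.+-suc k D)) k′<1+k+D , f⁺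

  pseudoInverse : ∀ {d} {f : Op d} → IsLinear f → PseudoInverse f (d ℕ.* d)
  pseudoInverse {d} {f} f-lin with annihilatingPolynomial f-lin
  ... | a , nonzero , a≈0 with pseudoInverse-from-poly f-lin a nonzero 0 a≈0
  ...   | k , k<1+d*d , f⁺ =
    ≡.subst (PseudoInverse f) (ℕP.m∸n+n≡m (ℕP.≤-pred k<1+d*d)) (raise-index f-lin f⁺ (d ℕ.* d ℕ.∸ k))

  -- π = f^k ∘ h^k is the projection onto the part of the space where f is invertible,
  -- along the part where f is nilpotent; β = f^k ∘ h^(k+1) inverts f there.
  module Projection {d k} {f : Op d} (f-lin : IsLinear f) (f⁺ : PseudoInverse f k) where
    open PseudoInverse f⁺
    open ≈ᵛ-Reasoning

    π β : Op d
    π v = (f ^ k) ((h ^ k) v)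
    β v = (f ^ k) ((h ^ suc k) v)

    f^k-lin : IsLinear (f ^ k)
    f^k-lin = ^-isLinear f-lin k

    π-cong : Congruent π
    π-cong = cong f^k-lin ∘ ^-cong h-cong k

    β-cong : Congruent β
    β-cong = cong f^k-lin ∘ ^-cong h-cong (suc k)

    h^-commute : ∀ g → IsLinear g → Commute g f → ∀ j → Commute g (h ^ j)
    h^-commute g g-lin g∘f≈f∘g = commute-^ (cong g-lin) h-cong (h-bicommutes g g-lin g∘f≈f∘g)

    f^-commute-h^ : ∀ j m → Commute (f ^ m) (h ^ j)
    f^-commute-h^ j m = h^-commute (f ^ m) (^-isLinear f-lin m) (λ w → ≈ᵛ-sym (^-commute f-lin m w)) j

    π-bicommutes : Bicommutes f π
    π-bicommutes g g-lin g∘f≈f∘g v = ≈ᵛ-trans (commute-^ (cong g-lin) (cong f-lin) g∘f≈f∘g k _)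
                                              (cong f^k-lin (h^-commute g g-lin g∘f≈f∘g k v))

    β-bicommutes : Bicommutes f β
    β-bicommutes g g-lin g∘f≈f∘g v = ≈ᵛ-trans (commute-^ (cong g-lin) (cong f-lin) g∘f≈f∘g k _)
                                              (cong f^k-lin (h^-commute g g-lin g∘f≈f∘g (suc k) v))

    f∘β≈π : ∀ v → f (β v) ≈ᵛ π v
    f∘β≈π v = ≈ᵛ-sym (f^k≈f^k+1∘h ((h ^ k) v))

    f^k≈f^j∘f^k∘h^j : ∀ j v → (f ^ k) v ≈ᵛ (f ^ j) ((f ^ k) ((h ^ j) v))
    f^k≈f^j∘f^k∘h^j zero v = ≈ᵛ-refl
    f^k≈f^j∘f^k∘h^j (suc j) v = begin
      (f ^ k) v                                  ≈⟨ f^k≈f^j∘f^k∘h^j j v ⟩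
      (f ^ j) ((f ^ k) ((h ^ j) v))              ≈⟨ cong (^-isLinear f-lin j) (f^k≈f^k+1∘h ((h ^ j) v)) ⟩
      (f ^ j) (f ((f ^ k) ((h ^ suc j) v)))      ≈⟨ ^-commute f-lin j _ ⟨
      (f ^ suc j) ((f ^ k) ((h ^ suc j) v))      ∎

    f^k∘π≈f^k : ∀ v → (f ^ k) (π v) ≈ᵛ (f ^ k) v
    f^k∘π≈f^k v = ≈ᵛ-sym (f^k≈f^j∘f^k∘h^j k v)

    f^m∘π≈f^m : ∀ {m} → k ℕ.≤ m → ∀ v → (f ^ m) (π v) ≈ᵛ (f ^ m) v
    f^m∘π≈f^m {m} k≤m v = ≡.subst (λ m → (f ^ m) (π v) ≈ᵛ (f ^ m) v) (ℕP.m∸n+n≡m k≤m)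
      (≡.subst₂ _≈ᵛ_ (≡.sym (^-+ f (m ℕ.∸ k) k (π v))) (≡.sym (^-+ f (m ℕ.∸ k) k v))
        (cong (^-isLinear f-lin (m ℕ.∸ k)) (f^k∘π≈f^k v)))

    π-idempotent : ∀ v → π (π v) ≈ᵛ π v
    π-idempotent v = begin
      (f ^ k) ((h ^ k) ((f ^ k) ((h ^ k) v)))    ≈⟨ cong f^k-lin (f^-commute-h^ k k ((h ^ k) v)) ⟨
      (f ^ k) (π ((h ^ k) v))                    ≈⟨ f^k∘π≈f^k ((h ^ k) v) ⟩
      π v                                        ∎

    π∘β∘f≈π : ∀ v → π (β (f v)) ≈ᵛ π v
    π∘β∘f≈π v = begin
      π (β (f v))    ≈⟨ π-cong (β-bicommutes f f-lin (λ _ → ≈ᵛ-refl) v) ⟨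
      π (f (β v))    ≈⟨ π-cong (f∘β≈π v) ⟩
      π (π v)        ≈⟨ π-idempotent v ⟩
      π v            ∎

  x+[y-y]≈x : ∀ {d} (x y : Vector d) → x +ᵛ (y -ᵛ y) ≈ᵛ x
  x+[y-y]≈x x y = pointwise λ i → trans (+-congˡ (-‿inverseʳ (y i))) (+-identityʳ (x i))

  z+[y-z]≈y : ∀ {d} (y z : Vector d) → z +ᵛ (y -ᵛ z) ≈ᵛ y
  z+[y-z]≈y y z = pointwise λ i → begin
    z i + (y i - z i)      ≈⟨ +-comm (z i) _ ⟩
    (y i - z i) + z i      ≈⟨ +-assoc (y i) (- z i) (z i) ⟩
    y i + (- z i + z i)    ≈⟨ +-congˡ (-‿inverseˡ (z i)) ⟩
    y i + 0#               ≈⟨ +-identityʳ (y i) ⟩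
    y i                    ∎
    where open ≈-Reasoning

  -- π (β M₀) takes care of the π-components of all the Mᵢ; on the kernel of π, where f₀ is
  -- nilpotent, the solution Q′ for the remaining maps is used.
  solution : ∀ {d k N} (f : Fin N → Op d) (M : Fin N → Vector d) →
             (∀ i → IsLinear (f i)) → (∀ i → PseudoInverse (f i) k) →
             (∀ i j → Commute (f i) (f j)) → (∀ i j → f i (M j) ≈ᵛ f j (M i)) →
             Σ (Vector d) λ Q → ∀ i {m} → k ℕ.≤ m → (f i ^ suc m) Q ≈ᵛ (f i ^ m) (M i)
  solution {N = zero} f M _ _ _ _ = 0ᵛ , λ ()
  solution {d} {k} {suc N} f M f-lin f⁺ f-comm M-comm = Q , solves
    where
    open Projection (f-lin fzero) (f⁺ fzero)
    open ≈ᵛ-Reasoning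

    rest : Σ (Vector d) λ Q′ → ∀ i {m} → k ℕ.≤ m → (f (fsuc i) ^ suc m) Q′ ≈ᵛ (f (fsuc i) ^ m) (M (fsuc i))
    rest = solution (f ∘ fsuc) (M ∘ fsuc) (f-lin ∘ fsuc) (f⁺ ∘ fsuc)
                    (λ i j → f-comm (fsuc i) (fsuc j)) (λ i j → M-comm (fsuc i) (fsuc j))

    Q′ Q : Vector d
    Q′ = proj₁ rest
    Q = π (β (M fzero)) +ᵛ (Q′ -ᵛ π Q′)

    fᵢ^-commute-π : ∀ i j v → (f i ^ j) (π v) ≈ᵛ π ((f i ^ j) v)
    fᵢ^-commute-π i j = π-bicommutes (f i ^ j) (^-isLinear (f-lin i) j)
                          (λ v → ≈ᵛ-sym (commute-^ (cong (f-lin fzero)) (cong (f-lin i)) (f-comm fzero i) j v))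

    fᵢ∘π∘β[M₀]≈π[Mᵢ] : ∀ i → f i (π (β (M fzero))) ≈ᵛ π (M i)
    fᵢ∘π∘β[M₀]≈π[Mᵢ] i = begin
      f i (π (β (M fzero)))    ≈⟨ π-bicommutes (f i) (f-lin i) (f-comm i fzero) _ ⟩
      π (f i (β (M fzero)))    ≈⟨ π-cong (β-bicommutes (f i) (f-lin i) (f-comm i fzero) _) ⟩
      π (β (f i (M fzero)))    ≈⟨ π-cong (β-cong (M-comm i fzero)) ⟩
      π (β (f fzero (M i)))    ≈⟨ π∘β∘f≈π (M i) ⟩
      π (M i)                  ∎

    split : ∀ i m → (f i ^ suc m) Q ≈ᵛ (f i ^ m) (π (M i)) +ᵛ ((f i ^ suc m) Q′ -ᵛ (f i ^ suc m) (π Q′))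
    split i m = begin
      (f i ^ suc m) Q
        ≈⟨ +-homo fᵢ^m+1-lin _ _ ⟩
      (f i ^ suc m) (π (β (M fzero))) +ᵛ (f i ^ suc m) (Q′ -ᵛ π Q′)
        ≈⟨ +ᵛ-cong (^-commute (f-lin i) m _) (-‿homo₂ fᵢ^m+1-lin Q′ (π Q′)) ⟩
      (f i ^ m) (f i (π (β (M fzero)))) +ᵛ ((f i ^ suc m) Q′ -ᵛ (f i ^ suc m) (π Q′))
        ≈⟨ +ᵛ-cong (cong (^-isLinear (f-lin i) m) (fᵢ∘π∘β[M₀]≈π[Mᵢ] i)) ≈ᵛ-refl ⟩
      (f i ^ m) (π (M i)) +ᵛ ((f i ^ suc m) Q′ -ᵛ (f i ^ suc m) (π Q′)) ∎
      where fᵢ^m+1-lin = ^-isLinear (f-lin i) (suc m)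

    solves : ∀ i {m} → k ℕ.≤ m → (f i ^ suc m) Q ≈ᵛ (f i ^ m) (M i)
    solves fzero {m} k≤m = begin
      (f fzero ^ suc m) Q
        ≈⟨ split fzero m ⟩
      (f fzero ^ m) (π (M fzero)) +ᵛ ((f fzero ^ suc m) Q′ -ᵛ (f fzero ^ suc m) (π Q′))
        ≈⟨ +ᵛ-cong (f^m∘π≈f^m k≤m (M fzero))
          (-ᵛ-cong ≈ᵛ-refl (f^m∘π≈f^m (ℕP.m≤n⇒m≤1+n k≤m) Q′)) ⟩
      (f fzero ^ m) (M fzero) +ᵛ ((f fzero ^ suc m) Q′ -ᵛ (f fzero ^ suc m) Q′)
        ≈⟨ x+[y-y]≈x _ _ ⟩
      (f fzero ^ m) (M fzero) ∎
    solves (fsuc i) {m} k≤m = begin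
      (fᵢ ^ suc m) Q
        ≈⟨ split (fsuc i) m ⟩
      (fᵢ ^ m) (π Mᵢ) +ᵛ ((fᵢ ^ suc m) Q′ -ᵛ (fᵢ ^ suc m) (π Q′))
        ≈⟨ +ᵛ-cong ≈ᵛ-refl (-ᵛ-cong (proj₂ rest i k≤m)
          (≈ᵛ-trans (fᵢ^-commute-π (fsuc i) (suc m) Q′) (π-cong (proj₂ rest i k≤m)))) ⟩
      (fᵢ ^ m) (π Mᵢ) +ᵛ ((fᵢ ^ m) Mᵢ -ᵛ π ((fᵢ ^ m) Mᵢ))
        ≈⟨ +ᵛ-cong ≈ᵛ-refl (-ᵛ-cong ≈ᵛ-refl (fᵢ^-commute-π (fsuc i) m Mᵢ)) ⟨
      (fᵢ ^ m) (π Mᵢ) +ᵛ ((fᵢ ^ m) Mᵢ -ᵛ (fᵢ ^ m) (π Mᵢ))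
        ≈⟨ z+[y-z]≈y _ _ ⟩
      (fᵢ ^ m) Mᵢ ∎
      where
      fᵢ = f (fsuc i)
      Mᵢ = M (fsuc i)

module RationalFunctionsModP (p : ℕ) (p-prime : Prime p) (n : ℕ) where
  open ≡ using (_≡_; refl)
  open PolynomialsModP p n using (polynomialRing; isDiscreteDomain; ≈P⇒≈; ≈⇒≈P)
  open FieldOfFractions polynomialRing (isDiscreteDomain p-prime) public
    using (Fraction; _≃_; cross; _⊗_; fractionField; fractionRing)
  open LinearAlgebra fractionField public
  open import Algebra.Definitions.RawMonoid (CommutativeRing.+-rawMonoid fractionRing) using (sum)

  fraction : (x : Frac n) → WF p x → Fraction
  fraction x x-wf = x , x-wf ∘ ≈⇒≈P

  fraction-wf : (x : Fraction) → WF p (proj₁ x)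
  fraction-wf (x , b≉0) = b≉0 ∘ ≈P⇒≈

  ≈F⇒≃ : ∀ {x y : Fraction} {x′ y′} → proj₁ x ≡ x′ → proj₁ y ≡ y′ →
         x′ ≈F[ p ] y′ → x ≃ y
  ≈F⇒≃ refl refl x≈y = cross (≈P⇒≈ x≈y)

  ≃⇒≈F : ∀ {x y : Fraction} {x′ y′} → proj₁ x ≡ x′ → proj₁ y ≡ y′ →
         x ≃ y → x′ ≈F[ p ] y′
  ≃⇒≈F refl refl (cross x≈y) = ≈⇒≈P x≈y

  raw : ∀ {d} → Vector d → Vect n d
  raw v = proj₁ ∘ v

  rawᴹ : ∀ {d} → Matrix d → Mat n d
  rawᴹ A i j = proj₁ (A i j)

  sumF-cong : ∀ d {f g : Fin d → Frac n} → (∀ j → f j ≡ g j) → sumF d f ≡ sumF d g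
  sumF-cong zero f≡g = refl
  sumF-cong (suc d) f≡g = ≡.cong₂ _+F_ (f≡g fzero) (sumF-cong d (f≡g ∘ fsuc))

  raw-sum : ∀ {d} (f : Fin d → Fraction) → proj₁ (sum f) ≡ sumF d (proj₁ ∘ f)
  raw-sum {zero} f = refl
  raw-sum {suc d} f = ≡.cong (proj₁ (f fzero) +F_) (raw-sum (f ∘ fsuc))

  apply-cong : ∀ {d} (B : Mat n d) {u v : Vect n d} → (∀ j → u j ≡ v j) → ∀ i → apply B u i ≡ apply B v i
  apply-cong {d} B u≡v i = sumF-cong d (λ j → ≡.cong (B i j *F_) (u≡v j))

  raw-⟦⟧ : ∀ {d} (A : Matrix d) v i → proj₁ (⟦ A ⟧ v i) ≡ apply (rawᴹ A) (raw v) i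
  raw-⟦⟧ A v i = raw-sum (λ j → A i j ⊗ v j)

  raw-^ : ∀ {d} (A : Matrix d) m v i → proj₁ ((⟦ A ⟧ ^ m) v i) ≡ iter (rawᴹ A) m (raw v) i
  raw-^ A zero v i = refl
  raw-^ A (suc m) v i = ≡.trans (raw-⟦⟧ A ((⟦ A ⟧ ^ m) v) i) (apply-cong (rawᴹ A) (raw-^ A m v) i)

n<m^n : ∀ {m} → 1 ℕ.< m → ∀ n → n ℕ.< m ℕ.^ n
n<m^n 1<m zero = ℕ.z<s
n<m^n {m} 1<m (suc n) = ℕP.≤-<-trans (n<m^n 1<m n) (ℕP.^-monoʳ-< m 1<m (ℕP.n<1+n n))

at-predecessor : ∀ {k} (P : ℕ → ℕ → Set) → (∀ {m} → k ℕ.≤ m → P (suc m) m) →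
                 ∀ {x} → k ℕ.< x → P x (x ℕ.∸ 1)
at-predecessor P P-suc (ℕ.s≤s k≤m) = P-suc k≤m

-- Only imported here: LinearAlgebra has its own _^_, for powers of maps.
open import Data.Nat using (_^_; _∸_)

lemma3p22 : (p : ℕ) → Prime p → (n d N : ℕ)
    → (φ : Fin N → Mat n d) → (M : Fin N → Vect n d)
    → (∀ i → WFM p (φ i)) → (∀ i → WFV p (M i))
    → (∀ i j (v : Vect n d) → WFV p v
        → apply (φ i) (apply (φ j) v) ≈V[ p ] apply (φ j) (apply (φ i) v))
    → (∀ i j → apply (φ i) (M j) ≈V[ p ] apply (φ j) (M i))
    → Σ (Vect n d) λ Q → WFV p Q × Σ ℕ λ ℓ → ∀ i
        → iter (φ i) (p ^ ℓ) Q ≈V[ p ] iter (φ i) (p ^ ℓ ∸ 1) (M i)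
lemma3p22 p p-prime n d N φ M φ-wf M-wf φ-comm M-comm =
  raw Q , fraction-wf ∘ Q , d ℕ.* d , λ i → at-predecessor (Solves i) (solves i) (n<m^n 1<p (d ℕ.* d))
  where
  open RationalFunctionsModP p p-prime n

  1<p : 1 ℕ.< p
  1<p = ℕ.nonTrivial⇒n>1 p {{prime⇒nonTrivial p-prime}}

  A : Fin N → Matrix d
  A i r s = fraction (φ i r s) (φ-wf i r s)

  Mᶠ : Fin N → Vector d
  Mᶠ i j = fraction (M i j) (M-wf i j)

  A-comm : ∀ i j → Commute ⟦ A i ⟧ ⟦ A j ⟧
  A-comm i j v = pointwise λ k →
    ≈F⇒≃ (≡.trans (raw-⟦⟧ (A i) (⟦ A j ⟧ v) k) (apply-cong (φ i) (raw-⟦⟧ (A j) v) k))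
         (≡.trans (raw-⟦⟧ (A j) (⟦ A i ⟧ v) k) (apply-cong (φ j) (raw-⟦⟧ (A i) v) k))
         (φ-comm i j (raw v) (fraction-wf ∘ v) k)

  Mᶠ-comm : ∀ i j → ⟦ A i ⟧ (Mᶠ j) ≈ᵛ ⟦ A j ⟧ (Mᶠ i)
  Mᶠ-comm i j = pointwise λ k → ≈F⇒≃ (raw-⟦⟧ (A i) (Mᶠ j) k) (raw-⟦⟧ (A j) (Mᶠ i) k) (M-comm i j k)

  Q-solution = solution (⟦_⟧ ∘ A) Mᶠ (⟦⟧-isLinear ∘ A) (pseudoInverse ∘ ⟦⟧-isLinear ∘ A) A-comm Mᶠ-comm

  Q : Vector d
  Q = proj₁ Q-solution

  Solves : Fin N → ℕ → ℕ → Set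
  Solves i x y = iter (φ i) x (raw Q) ≈V[ p ] iter (φ i) y (M i)

  solves : ∀ i {m} → d ℕ.* d ℕ.≤ m → Solves i (suc m) m
  solves i {m} d*d≤m k =
    ≃⇒≈F (raw-^ (A i) (suc m) Q k) (raw-^ (A i) m (Mᶠ i) k) (at (proj₂ Q-solution i d*d≤m) k)
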